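{- For every integer $n\geq0$, $$\sum_{k=0}^{n}(-1)^{k}{2n+1\brack 2k}(-q;q)_{2n-2k}\, T_{2k+1}(q)=\sum_{k=0}^{n} (-1)^{k} {2n+1\brack 2k}q^{2k} S_{2k}(q).$$ Equivalently, $\sum_{k=0}^{n}(-1)^{k}{2n+1\brack 2k}\bigl((-q;q)_{2n-2k} T_{2k+1}(q)-q^{2k} S_{2k}(q)\bigr)=0$.
   Context: For a nonnegative integer $m$, $(t;q)_m=\prod_{i=0}^{m-1}(1-tq^i)$; in particular $(-q;q)_m=(1+q)(1+q^2)\cdots(1+q^m)$. The $q$-binomial coefficient is ${m\brack j}=\frac{(q;q)_m}{(q;q)_{m-j}(q;q)_j}$ for $0\le j\le m$. The inversion number $\mathsf{inv}(\pi)$ of a permutation $\pi$ is the number of pairs $i<j$ with $\pi_i>\pi_j$. The $q$-tangent numbers $T_{2m+1}(q)$ are defined by $\frac{\sin_q(x)}{\cos_q(x)}=\sum_{m\geq0}T_{2m+1}(q)\frac{x^{2m+1}}{(q;q)_{2m+1}}$, where $\sin_q(x)=\sum_{m\geq0}(-1)^m\frac{x^{2m+1}}{(q;q)_{2m+1}}$ and $\cos_q(x)=\sum_{m\geq0}(-1)^m\frac{x^{2m}}{(q;q)_{2m}}$ (equivalently, $T_{2m+1}(q)=\sum q^{\mathsf{inv}(\pi)}$ over down-up permutations $\pi_1>\pi_2<\pi_3>\cdots$ of $[2m+1]$). The $q$-secant numbers are $S_0(q)=1$ and, for $m\ge1$, $S_{2m}(q)=\sum_{\pi}q^{\mathsf{inv}(\pi)}$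 summed over all up-down permutations $\pi_1<\pi_2>\pi_3<\cdots$ of $[2m]$. -}

module Defs where

open import Level using (Level)
open import Data.Nat using (ℕ; zero; suc; _<ᵇ_)
import Data.Nat as N
open import Data.Bool using (Bool; true; false; not; _∧_; if_then_else_; T?)
open import Data.List using (List; []; _∷_; map; concatMap; filter; length; upTo; foldr)
open import Data.Nat using (_<?_)
open import Algebra.Bundles using (CommutativeRing)

insertions : ℕ → List ℕ → List (List ℕ)
insertions x [] = (x ∷ []) ∷ []
insertions x (y ∷ ys) = (x ∷ y ∷ ys) ∷ map (y ∷_) (insertions x ys)

perms : List ℕ → List (List ℕ)
perms [] = [] ∷ []
perms (x ∷ xs) = concatMap (insertions x) (perms xs)

oneTo : ℕ → List ℕ
oneTo N = map suc (upTo N)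

inv : List ℕ → ℕ
inv [] = 0
inv (x ∷ xs) = length (filter (_<? x) xs) N.+ inv xs

alt : Bool → List ℕ → Bool
alt d (x ∷ y ∷ rest) = (if d then (y <ᵇ x) else (x <ᵇ y)) ∧ alt (not d) (y ∷ rest)
alt d _ = true

isDownUp : List ℕ → Bool
isDownUp = alt true

isUpDown : List ℕ → Bool
isUpDown = alt false

module QNumbers {c ℓ : Level} (R : CommutativeRing c ℓ) where
  open CommutativeRing R using (Carrier; _+_; _*_; -_; 0#; 1#)

  pow : Carrier → ℕ → Carrier
  pow x zero = 1#
  pow x (suc n) = x * pow x n

  sumR : List Carrier → Carrier
  sumR = foldr _+_ 0#

  signed : ℕ → Carrier → Carrier
  signed zero x = x
  signed (suc k) x = - (signed k x)

  -- q-binomial coefficient [m choose j], via the q-Pascal recurrence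
  -- [m+1, j+1] = [m, j] + q^(j+1) [m, j+1]; equals (q;q)_m/((q;q)_{m-j}(q;q)_j)
  qbinom : Carrier → ℕ → ℕ → Carrier
  qbinom q m zero = 1#
  qbinom q zero (suc j) = 0#
  qbinom q (suc m) (suc j) = qbinom q m j + pow q (suc j) * qbinom q m (suc j)

  negqPoch : Carrier → ℕ → Carrier
  negqPoch q zero = 1#
  negqPoch q (suc m) = negqPoch q m * (1# + pow q (suc m))

  invSum : Carrier → (List ℕ → Bool) → ℕ → Carrier
  invSum q P N = sumR (map (λ π → pow q (inv π)) (filter (λ π → T? (P π)) (perms (oneTo N))))

  -- q-tangent number T_{2m+1}(q): down-up permutations of [2m+1]
  qTan : Carrier → ℕ → Carrier
  qTan q m = invSum q isDownUp (suc (2 N.* m))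

  -- q-secant number S_{2m}(q): S_0 = 1, up-down permutations of [2m] for m ≥ 1
  qSec : Carrier → ℕ → Carrier
  qSec q zero = 1#
  qSec q (suc m) = invSum q isUpDown (2 N.* suc m)

  sumTo : ℕ → (ℕ → Carrier) → Carrier
  sumTo zero f = f zero
  sumTo (suc n) f = sumTo n f + f (suc n)

  lhs : Carrier → ℕ → Carrier
  lhs q n = sumTo n (λ k → signed k (qbinom q (suc (2 N.* n)) (2 N.* k) * negqPoch q (2 N.* n N.∸ 2 N.* k) * qTan q k))

  rhs : Carrier → ℕ → Carrier
  rhs q n = sumTo n (λ k → signed k (qbinom q (suc (2 N.* n)) (2 N.* k) * pow q (2 N.* k) * qSec q k))

-- Work with q-exponential generating functions Σ fₙ xⁿ/(q;q)ₙ over an arbitrary commutative ring: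
-- their product is the q-binomial convolution, the index shift D is the q-derivative (up to the
-- factor 1 - q), and D(FG) = DF·G + F(qx)·DG. Splitting permutations at their minimum entry shows
-- that the odd part t of the down-up series and the even part s of the up-down series satisfy
-- Dt = 1 + t(qx)·t and Ds = s(qx)·t, with t(0) = 0 and s(0) = 1; uniqueness of solutions then
-- gives t·cos = sin and s·cos = 1 for the q-cosine and q-sine. The series B with coefficient
-- (-1)ᵐ(-q;q)₂ₘ at x²ᵐ⁺¹/(q;q)₂ₘ₊₁ satisfies B·(cos² + sin²) = sin·cos, and
-- cos(x)cos(qx) + sin(qx)sin(x) = cos² + sin². Multiplying by the unit cos(x)cos(qx) therefore
-- gives Dt·B = s(qx)·sin, and the identity is its coefficient of x²ⁿ⁺¹.

module Submission where

open import Algebra.Bundles using (CommutativeRing; RawRing)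
open import Data.Nat as ℕ using (ℕ; zero; suc; _∸_; _≤_; _<_; z≤n; s≤s)
import Data.Nat.Properties as ℕₚ
open import Data.Product using (_×_; _,_; proj₁; proj₂)
open import Relation.Binary.PropositionalEquality as ≡ using (_≡_)
open import Defs

module IntegerCoefficientSolver {c ℓ} (R : CommutativeRing c ℓ) where
  open import Level using (0ℓ)
  open import Data.Maybe using (Maybe; just; nothing)
  open import Relation.Nullary using (yes; no)
  open import Algebra.Solver.Ring.AlmostCommutativeRing
  open CommutativeRing R hiding (zero)
  open import Algebra.Properties.Ring ring using (-‿involutive; -‿distribˡ-*; -‿distribʳ-*; -0#≈0#; -‿+-comm)
  open import Algebra.Properties.Semiring.Mult semiring using (×1-homo-*) renaming (_×_ to _·_)
  open import Algebra.Properties.Monoid.Mult +-monoid using (×-homo-+)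
  open import Algebra.Properties.CommutativeSemigroup +-commutativeSemigroup using (interchange)
  open import Relation.Binary.Reasoning.Setoid setoid

  -- A pair (a , b) stands for the integer a - b.
  ℕ² : RawRing 0ℓ 0ℓ
  ℕ² = record
    { Carrier = ℕ × ℕ
    ; _≈_ = _≡_
    ; _+_ = λ { (a , b) (a′ , b′) → (a ℕ.+ a′ , b ℕ.+ b′) }
    ; _*_ = λ { (a , b) (a′ , b′) → (a ℕ.* a′ ℕ.+ b ℕ.* b′ , a ℕ.* b′ ℕ.+ b ℕ.* a′) }
    ; -_ = λ { (a , b) → (b , a) }
    ; 0# = (0 , 0)
    ; 1# = (1 , 0)
    }

  ⟦_⟧ℕ : ℕ → Carrier
  ⟦ zero ⟧ℕ = 0#
  ⟦ suc zero ⟧ℕ = 1#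
  ⟦ suc (suc n) ⟧ℕ = 1# + ⟦ suc n ⟧ℕ

  -- Chosen so that the constants (1 , 0) and (0 , 0) denote 1# and 0# definitionally.
  ⟦_⟧ℤ : ℕ × ℕ → Carrier
  ⟦ (a , zero) ⟧ℤ = ⟦ a ⟧ℕ
  ⟦ (zero , suc b) ⟧ℤ = - ⟦ suc b ⟧ℕ
  ⟦ (suc a , suc b) ⟧ℤ = ⟦ (a , b) ⟧ℤ

  ⟦⟧ℕ≈·1# : ∀ n → ⟦ n ⟧ℕ ≈ n · 1#
  ⟦⟧ℕ≈·1# zero = refl
  ⟦⟧ℕ≈·1# (suc zero) = sym (+-identityʳ 1#)
  ⟦⟧ℕ≈·1# (suc (suc n)) = +-congˡ (⟦⟧ℕ≈·1# (suc n))

  -‿+-interchange : ∀ x y z w → (x - y) + (z - w) ≈ (x + z) - (y + w)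
  -‿+-interchange x y z w = trans (interchange x (- y) z (- w)) (+-congˡ (-‿+-comm y w))

  -‿*-interchange : ∀ a b a′ b′ → (a - b) * (a′ - b′) ≈ (a * a′ + b * b′) - (a * b′ + b * a′)
  -‿*-interchange a b a′ b′ = begin
    (a - b) * (a′ - b′)
      ≈⟨ distribʳ (a′ - b′) a (- b) ⟩
    a * (a′ - b′) + - b * (a′ - b′)
      ≈⟨ +-cong (distribˡ a a′ (- b′)) (distribˡ (- b) a′ (- b′)) ⟩
    (a * a′ + a * - b′) + (- b * a′ + - b * - b′)
      ≈⟨ +-cong (+-congˡ (sym (-‿distribʳ-* a b′))) (+-cong (sym (-‿distribˡ-* b a′)) neg*neg) ⟩
    (a * a′ - a * b′) + (- (b * a′) + b * b′)
      ≈⟨ +-congˡ (+-comm (- (b * a′)) (b * b′)) ⟩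
    (a * a′ - a * b′) + (b * b′ - b * a′)
      ≈⟨ -‿+-interchange (a * a′) (a * b′) (b * b′) (b * a′) ⟩
    (a * a′ + b * b′) - (a * b′ + b * a′) ∎
    where
    neg*neg : - b * - b′ ≈ b * b′
    neg*neg = trans (sym (-‿distribˡ-* b (- b′))) (trans (-‿cong (sym (-‿distribʳ-* b b′))) (-‿involutive _))

  ⟦⟧ℤ≈·1#-·1# : ∀ p → ⟦ p ⟧ℤ ≈ proj₁ p · 1# - proj₂ p · 1#
  ⟦⟧ℤ≈·1#-·1# (a , zero) = trans (⟦⟧ℕ≈·1# a) (sym (trans (+-congˡ -0#≈0#) (+-identityʳ _)))
  ⟦⟧ℤ≈·1#-·1# (zero , suc b) = trans (-‿cong (⟦⟧ℕ≈·1# (suc b))) (sym (+-identityˡ _))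
  ⟦⟧ℤ≈·1#-·1# (suc a , suc b) = trans (⟦⟧ℤ≈·1#-·1# (a , b)) (begin
    a · 1# - b · 1#                ≈⟨ sym (+-identityˡ _) ⟩
    0# + (a · 1# - b · 1#)         ≈⟨ +-congʳ (sym (-‿inverseʳ 1#)) ⟩
    (1# - 1#) + (a · 1# - b · 1#)  ≈⟨ -‿+-interchange 1# 1# (a · 1#) (b · 1#) ⟩
    (1# + a · 1#) - (1# + b · 1#)  ∎)

  homomorphism : ℕ² -Raw-AlmostCommutative⟶ fromCommutativeRing R
  homomorphism = record
    { ⟦_⟧ = ⟦_⟧ℤ
    ; +-homo = λ { (a , b) (a′ , b′) → begin
        ⟦ (a ℕ.+ a′ , b ℕ.+ b′) ⟧ℤ
          ≈⟨ ⟦⟧ℤ≈·1#-·1# (a ℕ.+ a′ , b ℕ.+ b′) ⟩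
        (a ℕ.+ a′) · 1# - (b ℕ.+ b′) · 1#
          ≈⟨ +-cong (×-homo-+ 1# a a′) (-‿cong (×-homo-+ 1# b b′)) ⟩
        (a · 1# + a′ · 1#) - (b · 1# + b′ · 1#)
          ≈⟨ sym (-‿+-interchange _ _ _ _) ⟩
        (a · 1# - b · 1#) + (a′ · 1# - b′ · 1#)
          ≈⟨ sym (+-cong (⟦⟧ℤ≈·1#-·1# (a , b)) (⟦⟧ℤ≈·1#-·1# (a′ , b′))) ⟩
        ⟦ (a , b) ⟧ℤ + ⟦ (a′ , b′) ⟧ℤ ∎ }
    ; *-homo = λ { (a , b) (a′ , b′) → begin
        ⟦ (a ℕ.* a′ ℕ.+ b ℕ.* b′ , a ℕ.* b′ ℕ.+ b ℕ.* a′) ⟧ℤ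
          ≈⟨ ⟦⟧ℤ≈·1#-·1# (a ℕ.* a′ ℕ.+ b ℕ.* b′ , a ℕ.* b′ ℕ.+ b ℕ.* a′) ⟩
        (a ℕ.* a′ ℕ.+ b ℕ.* b′) · 1# - (a ℕ.* b′ ℕ.+ b ℕ.* a′) · 1#
          ≈⟨ +-cong (×-homo-+ 1# (a ℕ.* a′) (b ℕ.* b′)) (-‿cong (×-homo-+ 1# (a ℕ.* b′) (b ℕ.* a′))) ⟩
        ((a ℕ.* a′) · 1# + (b ℕ.* b′) · 1#) - ((a ℕ.* b′) · 1# + (b ℕ.* a′) · 1#)
          ≈⟨ +-cong (+-cong (×1-homo-* a a′) (×1-homo-* b b′)) (-‿cong (+-cong (×1-homo-* a b′) (×1-homo-* b a′))) ⟩
        ((a · 1#) * (a′ · 1#) + (b · 1#) * (b′ · 1#)) - ((a · 1#) * (b′ · 1#) + (b · 1#) * (a′ · 1#))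
          ≈⟨ sym (-‿*-interchange _ _ _ _) ⟩
        (a · 1# - b · 1#) * (a′ · 1# - b′ · 1#)
          ≈⟨ sym (*-cong (⟦⟧ℤ≈·1#-·1# (a , b)) (⟦⟧ℤ≈·1#-·1# (a′ , b′))) ⟩
        ⟦ (a , b) ⟧ℤ * ⟦ (a′ , b′) ⟧ℤ ∎ }
    ; -‿homo = λ { (a , b) → begin
        ⟦ (b , a) ⟧ℤ              ≈⟨ ⟦⟧ℤ≈·1#-·1# (b , a) ⟩
        b · 1# - a · 1#          ≈⟨ sym (+-congʳ (-‿involutive _)) ⟩
        - - (b · 1#) - a · 1#    ≈⟨ -‿+-comm (- (b · 1#)) (a · 1#) ⟩
        - (- (b · 1#) + a · 1#)  ≈⟨ -‿cong (+-comm _ _) ⟩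
        - (a · 1# - b · 1#)      ≈⟨ -‿cong (sym (⟦⟧ℤ≈·1#-·1# (a , b))) ⟩
        - ⟦ (a , b) ⟧ℤ ∎ }
    ; 0-homo = refl
    ; 1-homo = refl
    }

  -‿cancel : ∀ x y z w → x + w ≈ z + y → x - y ≈ z - w
  -‿cancel x y z w e = begin
    x - y              ≈⟨ sym (+-identityʳ _) ⟩
    (x - y) + 0#       ≈⟨ +-congˡ (sym (-‿inverseʳ w)) ⟩
    (x - y) + (w - w)  ≈⟨ -‿+-interchange x y w w ⟩
    (x + w) - (y + w)  ≈⟨ +-cong e (-‿cong (+-comm y w)) ⟩
    (z + y) - (w + y)  ≈⟨ sym (-‿+-interchange z w y y) ⟩
    (z - w) + (y - y)  ≈⟨ +-congˡ (-‿inverseʳ y) ⟩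
    (z - w) + 0#       ≈⟨ +-identityʳ _ ⟩
    z - w              ∎

  ⟦⟧ℤ-equal? : ∀ p p′ → Maybe (⟦ p ⟧ℤ ≈ ⟦ p′ ⟧ℤ)
  ⟦⟧ℤ-equal? (a , b) (a′ , b′) with a ℕ.+ b′ ℕ.≟ a′ ℕ.+ b
  ... | no _ = nothing
  ... | yes e = just (begin
    ⟦ (a , b) ⟧ℤ          ≈⟨ ⟦⟧ℤ≈·1#-·1# (a , b) ⟩
    a · 1# - b · 1#      ≈⟨ -‿cancel _ _ _ _ (begin
      a · 1# + b′ · 1#     ≈⟨ sym (×-homo-+ 1# a b′) ⟩
      (a ℕ.+ b′) · 1#      ≡⟨ ≡.cong (_· 1#) e ⟩
      (a′ ℕ.+ b) · 1#      ≈⟨ ×-homo-+ 1# a′ b ⟩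
      a′ · 1# + b · 1#     ∎) ⟩
    a′ · 1# - b′ · 1#    ≈⟨ sym (⟦⟧ℤ≈·1#-·1# (a′ , b′)) ⟩
    ⟦ (a′ , b′) ⟧ℤ        ∎)

  open import Algebra.Solver.Ring ℕ² (fromCommutativeRing R) homomorphism ⟦⟧ℤ-equal? public

  :0 :1 : ∀ {n} → Polynomial n
  :0 = con (0 , 0)
  :1 = con (1 , 0)

module Parity where
  open import Data.Bool using (Bool; true; false; not; _xor_)
  open import Data.Bool.Properties using (not-involutive)

  odd : ℕ → Bool
  odd zero = false
  odd (suc n) = not (odd n)

  2*-suc : ∀ m → 2 ℕ.* suc m ≡ suc (suc (2 ℕ.* m))
  2*-suc m = ≡.cong suc (ℕₚ.+-suc m (m ℕ.+ 0))

  odd-+ : ∀ i j → odd (i ℕ.+ j) ≡ odd i xor odd j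
  odd-+ zero j = ≡.refl
  odd-+ (suc i) j rewrite odd-+ i j with odd i
  ... | true = not-involutive (odd j)
  ... | false = ≡.refl

  odd-2* : ∀ k → odd (2 ℕ.* k) ≡ false
  odd-2* zero = ≡.refl
  odd-2* (suc k) = ≡.trans (≡.cong odd (2*-suc k)) (≡.trans (not-involutive _) (odd-2* k))

  odd-∸ : ∀ n i → i ≤ n → odd (n ∸ i) ≡ odd n xor odd i
  odd-∸ n i i≤n with odd-+ i (n ∸ i)
  ... | e rewrite ℕₚ.m+[n∸m]≡n i≤n | e with odd i | odd (n ∸ i)
  ... | true  | true  = ≡.refl
  ... | true  | false = ≡.refl
  ... | false | true  = ≡.refl
  ... | false | false = ≡.refl

module FiniteSums {c ℓ} (R : CommutativeRing c ℓ) where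
  open import Data.Bool using (true)
  open import Data.Bool.Properties using (not-involutive)
  open import Data.List using (List; []; _∷_; _++_; map; concatMap)
  open import Data.List.Relation.Unary.All using (All; []; _∷_)
  open import Data.Nat.Tactic.RingSolver using (solve-∀)
  open CommutativeRing R hiding (zero)
  open import Algebra.Properties.Ring ring using (-‿involutive; -‿distribˡ-*; -‿+-comm)
  open QNumbers R
  open Parity using (odd; 2*-suc)
  open import Algebra.Properties.CommutativeSemigroup +-commutativeSemigroup using () renaming (interchange to +-interchange)
  open import Relation.Binary.Reasoning.Setoid setoid

  pow-+ : ∀ x m n → pow x (m ℕ.+ n) ≈ pow x m * pow x n
  pow-+ x zero n = sym (*-identityˡ _)
  pow-+ x (suc m) n = trans (*-congˡ (pow-+ x m n)) (sym (*-assoc _ _ _))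

  Σ : (ℕ → Carrier) → ℕ → Carrier
  Σ f zero = f zero
  Σ f (suc n) = f zero + Σ (λ i → f (suc i)) n

  Σ-cong : ∀ {f g} n → (∀ i → i ≤ n → f i ≈ g i) → Σ f n ≈ Σ g n
  Σ-cong zero e = e 0 z≤n
  Σ-cong (suc n) e = +-cong (e 0 z≤n) (Σ-cong n (λ i i≤n → e (suc i) (s≤s i≤n)))

  Σ-cong′ : ∀ {f g} n → (∀ i → f i ≈ g i) → Σ f n ≈ Σ g n
  Σ-cong′ n e = Σ-cong n (λ i _ → e i)

  Σ-zero : ∀ {f} n → (∀ i → i ≤ n → f i ≈ 0#) → Σ f n ≈ 0#
  Σ-zero n e = trans (Σ-cong n e) (Σ-const n)
    where
    Σ-const : ∀ n → Σ (λ _ → 0#) n ≈ 0#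
    Σ-const zero = refl
    Σ-const (suc n) = trans (+-identityˡ _) (Σ-const n)

  Σ-head : ∀ f n → (∀ i → f (suc i) ≈ 0#) → Σ f n ≈ f 0
  Σ-head f zero _ = refl
  Σ-head f (suc n) e = trans (+-congˡ (trans (Σ-head (λ i → f (suc i)) n (λ i → e (suc i))) (e 0))) (+-identityʳ _)

  Σ-+ : ∀ f g n → Σ (λ i → f i + g i) n ≈ Σ f n + Σ g n
  Σ-+ f g zero = refl
  Σ-+ f g (suc n) = trans (+-congˡ (Σ-+ _ _ n)) (+-interchange _ _ _ _)

  *-distribˡ-Σ : ∀ x f n → x * Σ f n ≈ Σ (λ i → x * f i) n
  *-distribˡ-Σ x f zero = refl
  *-distribˡ-Σ x f (suc n) = trans (distribˡ x _ _) (+-congˡ (*-distribˡ-Σ x _ n))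

  Σ-evens : ∀ n f → (∀ i → odd i ≡ true → f i ≈ 0#) → Σ f (suc (2 ℕ.* n)) ≈ Σ (λ k → f (2 ℕ.* k)) n
  Σ-evens zero f f-odd≈0 = trans (+-congˡ (f-odd≈0 1 ≡.refl)) (+-identityʳ _)
  Σ-evens (suc n) f f-odd≈0 = begin
    Σ f (suc (2 ℕ.* suc n))
      ≡⟨ ≡.cong (λ m → Σ f (suc m)) (2*-suc n) ⟩
    f 0 + (f 1 + Σ (λ i → f (suc (suc i))) (suc (2 ℕ.* n)))
      ≈⟨ +-congˡ (trans (+-cong (f-odd≈0 1 ≡.refl) (Σ-evens n (λ i → f (suc (suc i))) odd-shifted)) (+-identityˡ _)) ⟩
    f 0 + Σ (λ k → f (suc (suc (2 ℕ.* k)))) n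
      ≈⟨ +-congˡ (Σ-cong′ n (λ k → reflexive (≡.cong f (≡.sym (2*-suc k))))) ⟩
    f 0 + Σ (λ k → f (2 ℕ.* suc k)) n ∎
    where
    odd-shifted : ∀ i → odd i ≡ true → f (suc (suc i)) ≈ 0#
    odd-shifted i oddi = f-odd≈0 (suc (suc i)) (≡.trans (not-involutive (odd i)) oddi)

  sumTo≈Σ : ∀ n f → sumTo n f ≈ Σ f n
  sumTo≈Σ zero f = refl
  sumTo≈Σ (suc n) f = trans (+-congʳ (sumTo≈Σ n f)) (sym (Σ-snoc f n))
    where
    Σ-snoc : ∀ f n → Σ f (suc n) ≈ Σ f n + f (suc n)
    Σ-snoc f zero = refl
    Σ-snoc f (suc n) = trans (+-congˡ (Σ-snoc _ n)) (sym (+-assoc _ _ _))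

  Σˡ : {A : Set} → (A → Carrier) → List A → Carrier
  Σˡ f [] = 0#
  Σˡ f (x ∷ xs) = f x + Σˡ f xs

  module _ {A : Set} where

    Σˡ-cong : ∀ {f g : A → Carrier} xs → (∀ x → f x ≈ g x) → Σˡ f xs ≈ Σˡ g xs
    Σˡ-cong [] e = refl
    Σˡ-cong (x ∷ xs) e = +-cong (e x) (Σˡ-cong xs e)

    Σˡ-congᴬ : ∀ {f g : A → Carrier} {xs} → All (λ x → f x ≈ g x) xs → Σˡ f xs ≈ Σˡ g xs
    Σˡ-congᴬ [] = refl
    Σˡ-congᴬ (e ∷ es) = +-cong e (Σˡ-congᴬ es)

    Σˡ-zero : ∀ (xs : List A) → Σˡ (λ _ → 0#) xs ≈ 0#
    Σˡ-zero [] = refl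
    Σˡ-zero (x ∷ xs) = trans (+-identityˡ _) (Σˡ-zero xs)

    Σˡ-++ : ∀ (f : A → Carrier) xs ys → Σˡ f (xs ++ ys) ≈ Σˡ f xs + Σˡ f ys
    Σˡ-++ f [] ys = sym (+-identityˡ _)
    Σˡ-++ f (x ∷ xs) ys = trans (+-congˡ (Σˡ-++ f xs ys)) (sym (+-assoc _ _ _))

    Σˡ-+ : ∀ (f g : A → Carrier) xs → Σˡ (λ x → f x + g x) xs ≈ Σˡ f xs + Σˡ g xs
    Σˡ-+ f g [] = sym (+-identityˡ _)
    Σˡ-+ f g (x ∷ xs) = trans (+-congˡ (Σˡ-+ f g xs)) (+-interchange _ _ _ _)

    *-distribˡ-Σˡ : ∀ a (f : A → Carrier) xs → a * Σˡ f xs ≈ Σˡ (λ x → a * f x) xs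
    *-distribˡ-Σˡ a f [] = zeroʳ a
    *-distribˡ-Σˡ a f (x ∷ xs) = trans (distribˡ a _ _) (+-congˡ (*-distribˡ-Σˡ a f xs))

    *-distribʳ-Σˡ : ∀ a (f : A → Carrier) xs → Σˡ f xs * a ≈ Σˡ (λ x → f x * a) xs
    *-distribʳ-Σˡ a f xs = trans (*-comm _ a) (trans (*-distribˡ-Σˡ a f xs) (Σˡ-cong xs (λ x → *-comm a (f x))))

    Σˡ-Σ-comm : ∀ (f : A → ℕ → Carrier) xs n → Σˡ (λ a → Σ (f a) n) xs ≈ Σ (λ i → Σˡ (λ a → f a i) xs) n
    Σˡ-Σ-comm f [] n = sym (Σ-zero n (λ i _ → refl))
    Σˡ-Σ-comm f (x ∷ xs) n = trans (+-congˡ (Σˡ-Σ-comm f xs n)) (sym (Σ-+ _ _ n))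

  module _ {A B : Set} where

    Σˡ-map : ∀ (f : B → Carrier) (g : A → B) xs → Σˡ f (map g xs) ≈ Σˡ (λ x → f (g x)) xs
    Σˡ-map f g [] = refl
    Σˡ-map f g (x ∷ xs) = +-congˡ (Σˡ-map f g xs)

    Σˡ-concatMap : ∀ (f : B → Carrier) (g : A → List B) xs → Σˡ f (concatMap g xs) ≈ Σˡ (λ x → Σˡ f (g x)) xs
    Σˡ-concatMap f g [] = refl
    Σˡ-concatMap f g (x ∷ xs) = trans (Σˡ-++ f (g x) (concatMap g xs)) (+-congˡ (Σˡ-concatMap f g xs))

    Σˡ-comm : ∀ (f : A → B → Carrier) xs ys → Σˡ (λ a → Σˡ (f a) ys) xs ≈ Σˡ (λ b → Σˡ (λ a → f a b) xs) ys
    Σˡ-comm f [] ys = sym (Σˡ-zero ys)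
    Σˡ-comm f (x ∷ xs) ys = trans (+-congˡ (Σˡ-comm f xs ys)) (sym (Σˡ-+ _ _ ys))

  signed-cong : ∀ m {x y} → x ≈ y → signed m x ≈ signed m y
  signed-cong zero e = e
  signed-cong (suc m) e = -‿cong (signed-cong m e)

  signed-*ˡ : ∀ m x y → signed m x * y ≈ signed m (x * y)
  signed-*ˡ zero x y = refl
  signed-*ˡ (suc m) x y = trans (sym (-‿distribˡ-* _ y)) (-‿cong (signed-*ˡ m x y))

  signed-*ʳ : ∀ m x y → x * signed m y ≈ signed m (x * y)
  signed-*ʳ m x y = trans (*-comm x _) (trans (signed-*ˡ m y x) (signed-cong m (*-comm y x)))

  signed-Σ : ∀ m f n → signed m (Σ f n) ≈ Σ (λ i → signed m (f i)) n
  signed-Σ m f zero = refl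
  signed-Σ m f (suc n) = trans (signed-+ m _ _) (+-congˡ (signed-Σ m _ n))
    where
    signed-+ : ∀ m x y → signed m (x + y) ≈ signed m x + signed m y
    signed-+ zero x y = refl
    signed-+ (suc m) x y = trans (-‿cong (signed-+ m x y)) (sym (-‿+-comm _ _))

  signed-+ℕ : ∀ a b x → signed (a ℕ.+ b) x ≡ signed a (signed b x)
  signed-+ℕ zero b x = ≡.refl
  signed-+ℕ (suc a) b x = ≡.cong -_ (signed-+ℕ a b x)

  signed-2* : ∀ j x → signed (2 ℕ.* j) x ≈ x
  signed-2* zero x = refl
  signed-2* (suc j) x = trans (reflexive (≡.cong (λ k → signed k x) (2*-suc j))) (trans (-‿involutive _) (signed-2* j x))

  signed-∸ : ∀ n k → k ≤ n → ∀ x → signed n (signed (n ∸ k) x) ≈ signed k x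
  signed-∸ n k k≤n x = begin
    signed n (signed (n ∸ k) x)            ≡⟨ signed-+ℕ n (n ∸ k) x ⟨
    signed (n ℕ.+ (n ∸ k)) x               ≡⟨ ≡.cong (λ m → signed m x) exponent ⟩
    signed (k ℕ.+ 2 ℕ.* (n ∸ k)) x         ≡⟨ signed-+ℕ k (2 ℕ.* (n ∸ k)) x ⟩
    signed k (signed (2 ℕ.* (n ∸ k)) x)    ≈⟨ signed-cong k (signed-2* (n ∸ k) x) ⟩
    signed k x                             ∎
    where
    regroup : ∀ a b → a ℕ.+ b ℕ.+ b ≡ a ℕ.+ 2 ℕ.* b
    regroup = solve-∀
    exponent : n ℕ.+ (n ∸ k) ≡ k ℕ.+ 2 ℕ.* (n ∸ k)
    exponent = ≡.trans (≡.cong (ℕ._+ (n ∸ k)) (≡.sym (ℕₚ.m+[n∸m]≡n k≤n))) (regroup k (n ∸ k))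

module QExponentialSeries {c ℓ} (R : CommutativeRing c ℓ) (q : CommutativeRing.Carrier R) where
  open import Data.Nat.Induction using (<-rec)
  open import Data.Bool using (true)
  open Parity using (odd)
  open CommutativeRing R hiding (zero)
  open QNumbers R
  open FiniteSums R
  open IntegerCoefficientSolver R using (solve; _:=_; _:+_; _:*_; _:-_; :-_; :0; :1)
  open import Algebra.Properties.CommutativeSemigroup +-commutativeSemigroup using () renaming (interchange to +-interchange)
  open import Relation.Binary.Reasoning.Setoid setoid

  -- [i + j choose i], indexed by the two parts.
  qbin : ℕ → ℕ → Carrier
  qbin zero j = 1#
  qbin (suc i) zero = 1#
  qbin (suc i) (suc j) = qbin i (suc j) + pow q (suc i) * qbin (suc i) j

  qbin-zeroʳ : ∀ i → qbin i 0 ≈ 1#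
  qbin-zeroʳ zero = refl
  qbin-zeroʳ (suc i) = refl

  qbin-pascal′ : ∀ i j → qbin (suc i) (suc j) ≈ pow q (suc j) * qbin i (suc j) + qbin (suc i) j
  qbin-pascal′ zero j = row j
    where
    row : ∀ j → qbin 1 (suc j) ≈ pow q (suc j) * 1# + qbin 1 j
    row zero = solve 1 (λ x → :1 :+ (x :* :1) :* :1 := x :* :1 :* :1 :+ :1) refl q
    row (suc j) = trans (+-congˡ (*-congˡ (row j)))
      (solve 3 (λ x p b → :1 :+ (x :* :1) :* (p :* :1 :+ b) := x :* p :* :1 :+ (:1 :+ (x :* :1) :* b)) refl q (pow q (suc j)) (qbin 1 j))
  qbin-pascal′ (suc i) zero = column (suc i)
    where
    column : ∀ i → qbin i 1 + pow q (suc i) * 1# ≈ pow q 1 * qbin i 1 + 1#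
    column zero = solve 1 (λ x → :1 :+ (x :* :1) :* :1 := (x :* :1) :* :1 :+ :1) refl q
    column (suc i) = trans (+-congʳ (column i))
      (solve 3 (λ x p b → ((x :* :1) :* b :+ :1) :+ x :* p :* :1 := (x :* :1) :* (b :+ p :* :1) :+ :1) refl q (pow q (suc i)) (qbin i 1))
  qbin-pascal′ (suc i) (suc j) = trans (+-cong (qbin-pascal′ i (suc j)) (*-congˡ (qbin-pascal′ (suc i) j)))
    (solve 6 (λ x pi pj a b c → (x :* pj :* a :+ b) :+ x :* pi :* (pj :* b :+ c) := x :* pj :* (a :+ pi :* b) :+ (b :+ x :* pi :* c)) refl
      q (pow q (suc i)) (pow q (suc j)) (qbin i (suc (suc j))) (qbin (suc i) (suc j)) (qbin (suc (suc i)) j))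

  qbinom-zero : ∀ n m → n < m → qbinom q n m ≈ 0#
  qbinom-zero zero (suc m) _ = refl
  qbinom-zero (suc n) (suc m) (s≤s n<m) =
    trans (+-cong (qbinom-zero n m n<m) (trans (*-congˡ (qbinom-zero n (suc m) (ℕₚ.m<n⇒m<1+n n<m))) (zeroʳ _))) (+-identityʳ 0#)

  qbinom-diag : ∀ n → qbinom q n n ≈ 1#
  qbinom-diag zero = refl
  qbinom-diag (suc n) = trans (+-cong (qbinom-diag n) (trans (*-congˡ (qbinom-zero n (suc n) (ℕₚ.n<1+n n))) (zeroʳ _))) (+-identityʳ 1#)

  qbinom+≈qbin : ∀ i j → qbinom q (i ℕ.+ j) i ≈ qbin i j
  qbinom+≈qbin zero j = refl
  qbinom+≈qbin (suc i) zero = trans (reflexive (≡.cong (λ m → qbinom q m (suc i)) (ℕₚ.+-identityʳ (suc i)))) (qbinom-diag (suc i))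
  qbinom+≈qbin (suc i) (suc j) = +-cong (qbinom+≈qbin i (suc j))
    (*-congˡ (trans (reflexive (≡.cong (λ m → qbinom q m (suc i)) (ℕₚ.+-suc i j))) (qbinom+≈qbin (suc i) j)))

  qbinom≈qbin : ∀ n i → i ≤ n → qbinom q n i ≈ qbin i (n ∸ i)
  qbinom≈qbin n i i≤n = trans (reflexive (≡.cong (λ m → qbinom q m i) (≡.sym (ℕₚ.m+[n∸m]≡n i≤n)))) (qbinom+≈qbin i (n ∸ i))

  -- Coefficient lists of q-exponential series Σ fₙ xⁿ/(q;q)ₙ: _⊛_ is their product, D is (1 - q)
  -- times the q-derivative, and dilate is the substitution x ↦ qx.
  Seq : Set c
  Seq = ℕ → Carrier

  infix 4 _≋_
  _≋_ : Seq → Seq → Set ℓ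
  f ≋ g = ∀ n → f n ≈ g n

  infixl 6 _⊕_
  infixl 7 _⊛_
  infix 8 ⊖_

  _⊕_ : Seq → Seq → Seq
  (f ⊕ g) n = f n + g n

  ⊖_ : Seq → Seq
  (⊖ f) n = - f n

  𝟘 : Seq
  𝟘 n = 0#

  𝟙 : Seq
  𝟙 zero = 1#
  𝟙 (suc n) = 0#

  antidiagonal : (ℕ → ℕ → Carrier) → ℕ → Carrier
  antidiagonal h n = Σ (λ i → h i (n ∸ i)) n

  _⊛_ : Seq → Seq → Seq
  f ⊛ g = antidiagonal (λ i j → qbin i j * f i * g j)

  D : Seq → Seq
  D f n = f (suc n)

  dilate : Seq → Seq
  dilate f n = pow q n * f n

  antidiagonal-suc : ∀ {H A B : ℕ → ℕ → Carrier} →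
    (∀ j → H 0 (suc j) ≈ B 0 j) → (∀ i → H (suc i) 0 ≈ A i 0) →
    (∀ i j → H (suc i) (suc j) ≈ A i (suc j) + B (suc i) j) →
    ∀ n → antidiagonal H (suc n) ≈ antidiagonal A n + antidiagonal B n
  antidiagonal-suc {H} {A} {B} left bottom inner zero = trans (+-cong (left 0) (bottom 0)) (+-comm _ _)
  antidiagonal-suc {H} {A} {B} left bottom inner (suc n) =
    trans (+-cong (left (suc n)) (shifted {λ i j → H (suc i) j} {A} {λ i j → B (suc i) j} bottom inner n))
          (solve 3 (λ a b c → a :+ (b :+ c) := b :+ (a :+ c)) refl _ _ _)
    where
    shifted : ∀ {H A B : ℕ → ℕ → Carrier} → (∀ i → H i 0 ≈ A i 0) → (∀ i j → H i (suc j) ≈ A i (suc j) + B i j) →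
              ∀ n → antidiagonal H (suc n) ≈ antidiagonal A (suc n) + antidiagonal B n
    shifted {H} {A} {B} bottom inner zero =
      trans (+-cong (inner 0 0) (bottom 1)) (solve 3 (λ a b c → (a :+ b) :+ c := (a :+ c) :+ b) refl (A 0 1) (B 0 0) (A 1 0))
    shifted {H} {A} {B} bottom inner (suc n) =
      trans (+-cong (inner 0 (suc n)) (shifted {λ i j → H (suc i) j} {λ i j → A (suc i) j} {λ i j → B (suc i) j}
                                                 (λ i → bottom (suc i)) (λ i j → inner (suc i) j) n)) (+-interchange _ _ _ _)

  D-⊛ : ∀ f g → D (f ⊛ g) ≋ D f ⊛ g ⊕ dilate f ⊛ D g
  D-⊛ f g = antidiagonal-suc {λ i j → qbin i j * f i * g j} {λ i j → qbin i j * f (suc i) * g j}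
                             {λ i j → qbin i j * (pow q i * f i) * g (suc j)}
    (λ j → solve 2 (λ a b → :1 :* a :* b := :1 :* (:1 :* a) :* b) refl (f 0) (g (suc j)))
    (λ i → *-congʳ (*-congʳ (sym (qbin-zeroʳ i))))
    (λ i j → solve 5 (λ a p b x y → (a :+ p :* b) :* x :* y := a :* x :* y :+ b :* (p :* x) :* y) refl
               (qbin i (suc j)) (pow q (suc i)) (qbin (suc i) j) (f (suc i)) (g (suc j)))

  D-⊛′ : ∀ f g → D (f ⊛ g) ≋ D f ⊛ dilate g ⊕ f ⊛ D g
  D-⊛′ f g = antidiagonal-suc {λ i j → qbin i j * f i * g j} {λ i j → qbin i j * f (suc i) * (pow q j * g j)}
                              {λ i j → qbin i j * f i * g (suc j)}
    (λ j → refl)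
    (λ i → trans (*-congʳ (*-congʳ (sym (qbin-zeroʳ i)))) (*-congˡ (sym (*-identityˡ _))))
    (λ i j → trans (*-congʳ (*-congʳ (qbin-pascal′ i j)))
       (solve 5 (λ a p b x y → (p :* a :+ b) :* x :* y := a :* x :* (p :* y) :+ b :* x :* y) refl
          (qbin i (suc j)) (pow q (suc j)) (qbin (suc i) j) (f (suc i)) (g (suc j))))

  ⊕-cong : ∀ {f f′ g g′} → f ≋ f′ → g ≋ g′ → f ⊕ g ≋ f′ ⊕ g′
  ⊕-cong f≋f′ g≋g′ n = +-cong (f≋f′ n) (g≋g′ n)

  ⊛-cong : ∀ {f f′ g g′} → f ≋ f′ → g ≋ g′ → f ⊛ g ≋ f′ ⊛ g′
  ⊛-cong f≋f′ g≋g′ n = Σ-cong′ n (λ i → *-cong (*-congˡ (f≋f′ i)) (g≋g′ (n ∸ i)))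

  ⊛-congˡ : ∀ f {g g′} → g ≋ g′ → f ⊛ g ≋ f ⊛ g′
  ⊛-congˡ f = ⊛-cong {f} {f} (λ _ → refl)

  ⊛-congʳ : ∀ g {f f′} → f ≋ f′ → f ⊛ g ≋ f′ ⊛ g
  ⊛-congʳ g {f} {f′} f≋f′ = ⊛-cong {f} {f′} {g} {g} f≋f′ (λ _ → refl)

  ⊛-distribʳ : ∀ h f g → (f ⊕ g) ⊛ h ≋ f ⊛ h ⊕ g ⊛ h
  ⊛-distribʳ h f g n = trans (Σ-cong′ n (λ i → solve 4 (λ a x y z → a :* (x :+ y) :* z := a :* x :* z :+ a :* y :* z) refl _ _ _ _)) (Σ-+ _ _ n)

  ⊛-distribˡ : ∀ h f g → h ⊛ (f ⊕ g) ≋ h ⊛ f ⊕ h ⊛ g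
  ⊛-distribˡ h f g n = trans (Σ-cong′ n (λ i → solve 4 (λ a z x y → a :* z :* (x :+ y) := a :* z :* x :+ a :* z :* y) refl _ _ _ _)) (Σ-+ _ _ n)

  ⊛-comm : ∀ f g → f ⊛ g ≋ g ⊛ f
  ⊛-comm f g zero = solve 2 (λ x y → :1 :* x :* y := :1 :* y :* x) refl (f 0) (g 0)
  ⊛-comm f g (suc n) = begin
    D (f ⊛ g) n                          ≈⟨ D-⊛ f g n ⟩
    (D f ⊛ g) n + (dilate f ⊛ D g) n     ≈⟨ +-cong (⊛-comm (D f) g n) (⊛-comm (dilate f) (D g) n) ⟩
    (g ⊛ D f) n + (D g ⊛ dilate f) n     ≈⟨ +-comm _ _ ⟩
    (D g ⊛ dilate f) n + (g ⊛ D f) n     ≈⟨ D-⊛′ g f n ⟨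
    D (g ⊛ f) n                          ∎

  dilate-cong : ∀ {f g} → f ≋ g → dilate f ≋ dilate g
  dilate-cong f≋g n = *-congˡ (f≋g n)

  dilate-⊛ : ∀ f g → dilate (f ⊛ g) ≋ dilate f ⊛ dilate g
  dilate-⊛ f g n = trans (*-distribˡ-Σ _ _ n) (Σ-cong n (λ i i≤n → begin
    pow q n * (qbin i (n ∸ i) * f i * g (n ∸ i))
      ≈⟨ *-congʳ (trans (reflexive (≡.cong (pow q) (≡.sym (ℕₚ.m+[n∸m]≡n i≤n)))) (pow-+ q i (n ∸ i))) ⟩
    (pow q i * pow q (n ∸ i)) * (qbin i (n ∸ i) * f i * g (n ∸ i))
      ≈⟨ solve 5 (λ a b c x y → (a :* b) :* (c :* x :* y) := c :* (a :* x) :* (b :* y)) refl _ _ _ _ _ ⟩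
    qbin i (n ∸ i) * (pow q i * f i) * (pow q (n ∸ i) * g (n ∸ i)) ∎))

  ⊛-assoc : ∀ f g h → (f ⊛ g) ⊛ h ≋ f ⊛ (g ⊛ h)
  ⊛-assoc f g h zero = solve 3 (λ x y z → :1 :* (:1 :* x :* y) :* z := :1 :* x :* (:1 :* y :* z)) refl (f 0) (g 0) (h 0)
  ⊛-assoc f g h (suc n) = begin
    D ((f ⊛ g) ⊛ h) n
      ≈⟨ D-⊛ (f ⊛ g) h n ⟩
    (D (f ⊛ g) ⊛ h) n + (dilate (f ⊛ g) ⊛ D h) n
      ≈⟨ +-cong (⊛-congʳ h (D-⊛ f g) n) (⊛-congʳ (D h) (dilate-⊛ f g) n) ⟩
    ((D f ⊛ g ⊕ dilate f ⊛ D g) ⊛ h) n + ((dilate f ⊛ dilate g) ⊛ D h) n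
      ≈⟨ +-congʳ (⊛-distribʳ h (D f ⊛ g) (dilate f ⊛ D g) n) ⟩
    ((D f ⊛ g) ⊛ h) n + ((dilate f ⊛ D g) ⊛ h) n + ((dilate f ⊛ dilate g) ⊛ D h) n
      ≈⟨ +-cong (+-cong (⊛-assoc (D f) g h n) (⊛-assoc (dilate f) (D g) h n)) (⊛-assoc (dilate f) (dilate g) (D h) n) ⟩
    (D f ⊛ (g ⊛ h)) n + (dilate f ⊛ (D g ⊛ h)) n + (dilate f ⊛ (dilate g ⊛ D h)) n
      ≈⟨ +-assoc _ _ _ ⟩
    (D f ⊛ (g ⊛ h)) n + ((dilate f ⊛ (D g ⊛ h)) n + (dilate f ⊛ (dilate g ⊛ D h)) n)
      ≈⟨ +-congˡ (⊛-distribˡ (dilate f) (D g ⊛ h) (dilate g ⊛ D h) n) ⟨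
    (D f ⊛ (g ⊛ h)) n + (dilate f ⊛ (D g ⊛ h ⊕ dilate g ⊛ D h)) n
      ≈⟨ +-congˡ (⊛-congˡ (dilate f) (D-⊛ g h) n) ⟨
    (D f ⊛ (g ⊛ h)) n + (dilate f ⊛ D (g ⊛ h)) n
      ≈⟨ D-⊛ f (g ⊛ h) n ⟨
    D (f ⊛ (g ⊛ h)) n ∎

  ⊛-identityˡ : ∀ f → 𝟙 ⊛ f ≋ f
  ⊛-identityˡ f zero = solve 1 (λ x → :1 :* :1 :* x := x) refl (f 0)
  ⊛-identityˡ f (suc n) = trans (+-cong (solve 1 (λ x → :1 :* :1 :* x := x) refl (f (suc n)))
                                         (Σ-zero n (λ i _ → trans (*-congʳ (zeroʳ _)) (zeroˡ _)))) (+-identityʳ _)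

  ⊛-identityʳ : ∀ f → f ⊛ 𝟙 ≋ f
  ⊛-identityʳ f n = trans (⊛-comm f 𝟙 n) (⊛-identityˡ f n)

  seqRing : CommutativeRing c ℓ
  seqRing = record
    { Carrier = Seq
    ; _≈_ = _≋_
    ; _+_ = _⊕_
    ; _*_ = _⊛_
    ; -_ = ⊖_
    ; 0# = 𝟘
    ; 1# = 𝟙
    ; isCommutativeRing = record
      { isRing = record
        { +-isAbelianGroup = record
          { isGroup = record
            { isMonoid = record
              { isSemigroup = record
                { isMagma = record
                  { isEquivalence = record
                    { refl = λ n → refl ; sym = λ e n → sym (e n) ; trans = λ e e′ n → trans (e n) (e′ n) }
                  ; ∙-cong = ⊕-cong }
                ; assoc = λ f g h n → +-assoc (f n) (g n) (h n) }
              ; identity = (λ f n → +-identityˡ (f n)) , (λ f n → +-identityʳ (f n)) }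
            ; inverse = (λ f n → -‿inverseˡ (f n)) , (λ f n → -‿inverseʳ (f n))
            ; ⁻¹-cong = λ e n → -‿cong (e n) }
          ; comm = λ f g n → +-comm (f n) (g n) }
        ; *-cong = ⊛-cong
        ; *-assoc = ⊛-assoc
        ; *-identity = ⊛-identityˡ , ⊛-identityʳ
        ; distrib = ⊛-distribˡ , ⊛-distribʳ }
      ; *-comm = ⊛-comm }
    }

  D≋⊛⇒≋𝟘 : ∀ f a → f 0 ≈ 0# → D f ≋ a ⊛ f → f ≋ 𝟘
  D≋⊛⇒≋𝟘 f a f₀≈0 Df≋af = <-rec (λ n → f n ≈ 0#) step
    where
    step : ∀ n → (∀ {k} → k < n → f k ≈ 0#) → f n ≈ 0#
    step zero _ = f₀≈0
    step (suc n) ih = trans (Df≋af n) (Σ-zero n (λ i _ → trans (*-congˡ (ih (s≤s (ℕₚ.m∸n≤m n i)))) (zeroʳ _)))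

  ⊛≋𝟘⇒≋𝟘 : ∀ g f → g 0 ≈ 1# → g ⊛ f ≋ 𝟘 → f ≋ 𝟘
  ⊛≋𝟘⇒≋𝟘 g f g₀≈1 gf≋𝟘 = <-rec (λ n → f n ≈ 0#) step
    where
    leading : ∀ n → qbin 0 n * g 0 * f n ≈ f n
    leading n = trans (*-congʳ (trans (*-identityˡ _) g₀≈1)) (*-identityˡ _)
    step : ∀ n → (∀ {k} → k < n → f k ≈ 0#) → f n ≈ 0#
    step zero _ = trans (sym (leading 0)) (gf≋𝟘 0)
    step (suc n) ih = begin
      f (suc n)                                    ≈⟨ leading (suc n) ⟨
      qbin 0 (suc n) * g 0 * f (suc n)             ≈⟨ +-identityʳ _ ⟨
      qbin 0 (suc n) * g 0 * f (suc n) + 0#        ≈⟨ +-congˡ (Σ-zero n (λ i _ → trans (*-congˡ (ih (s≤s (ℕₚ.m∸n≤m n i)))) (zeroʳ _))) ⟨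
      (g ⊛ f) (suc n)                              ≈⟨ gf≋𝟘 (suc n) ⟩
      0#                                           ∎

  -- The series x itself: its coefficient of x¹/(q;q)₁ is 1 - q.
  X : Seq
  X zero = 0#
  X (suc zero) = 1# - q
  X (suc (suc n)) = 0#

  qbin-1-*-1-q : ∀ n → qbin 1 n * (1# - q) ≈ 1# - pow q (suc n)
  qbin-1-*-1-q zero = solve 1 (λ x → :1 :* (:1 :- x) := :1 :- x :* :1) refl q
  qbin-1-*-1-q (suc n) = begin
    (1# + pow q 1 * qbin 1 n) * (1# - q)
      ≈⟨ solve 2 (λ x b → (:1 :+ (x :* :1) :* b) :* (:1 :- x) := (:1 :- x) :+ x :* (b :* (:1 :- x))) refl q (qbin 1 n) ⟩
    (1# - q) + q * (qbin 1 n * (1# - q))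
      ≈⟨ +-congˡ (*-congˡ (qbin-1-*-1-q n)) ⟩
    (1# - q) + q * (1# - pow q (suc n))
      ≈⟨ solve 2 (λ x p → (:1 :- x) :+ x :* (:1 :- p) := :1 :- x :* p) refl q (pow q (suc n)) ⟩
    1# - pow q (suc (suc n)) ∎

  f-dilate≋X⊛D : ∀ f → f ⊕ ⊖ dilate f ≋ X ⊛ D f
  f-dilate≋X⊛D f zero = trans (solve 1 (λ x → x :- :1 :* x := :0) refl (f 0)) (sym (trans (*-congʳ (zeroʳ _)) (zeroˡ _)))
  f-dilate≋X⊛D f (suc n) = sym (begin
    (X ⊛ D f) (suc n)
      ≈⟨ +-cong (trans (*-congʳ (zeroʳ _)) (zeroˡ _)) (Σ-head _ n (λ i → trans (*-congʳ (zeroʳ _)) (zeroˡ _))) ⟩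
    0# + qbin 1 n * (1# - q) * f (suc n)
      ≈⟨ +-identityˡ _ ⟩
    qbin 1 n * (1# - q) * f (suc n)
      ≈⟨ *-congʳ (qbin-1-*-1-q n) ⟩
    (1# - pow q (suc n)) * f (suc n)
      ≈⟨ solve 2 (λ p x → (:1 :- p) :* x := x :- p :* x) refl (pow q (suc n)) (f (suc n)) ⟩
    f (suc n) - pow q (suc n) * f (suc n) ∎)

  ⊛-at-odd : ∀ f g n → (∀ i → odd i ≡ true → f i ≈ 0#) →
    (f ⊛ g) (suc (2 ℕ.* n)) ≈ Σ (λ k → qbinom q (suc (2 ℕ.* n)) (2 ℕ.* k) * f (2 ℕ.* k) * g (suc (2 ℕ.* (n ∸ k)))) n
  ⊛-at-odd f g n f-odd≈0 = trans (Σ-evens n _ term-odd≈0) (Σ-cong n term-even)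
    where
    N : ℕ
    N = suc (2 ℕ.* n)
    term-odd≈0 : ∀ i → odd i ≡ true → qbin i (N ∸ i) * f i * g (N ∸ i) ≈ 0#
    term-odd≈0 i oddi = trans (*-congʳ (trans (*-congˡ (f-odd≈0 i oddi)) (zeroʳ _))) (zeroˡ _)
    term-even : ∀ k → k ≤ n → qbin (2 ℕ.* k) (N ∸ 2 ℕ.* k) * f (2 ℕ.* k) * g (N ∸ 2 ℕ.* k)
                              ≈ qbinom q N (2 ℕ.* k) * f (2 ℕ.* k) * g (suc (2 ℕ.* (n ∸ k)))
    term-even k k≤n = *-cong (*-congʳ (sym (qbinom≈qbin N (2 ℕ.* k) (ℕₚ.≤-trans 2k≤2n (ℕₚ.n≤1+n _)))))
                             (reflexive (≡.cong g N∸2k≡1+2[n∸k]))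
      where
      2k≤2n : 2 ℕ.* k ≤ 2 ℕ.* n
      2k≤2n = ℕₚ.*-monoʳ-≤ 2 k≤n
      N∸2k≡1+2[n∸k] : N ∸ 2 ℕ.* k ≡ suc (2 ℕ.* (n ∸ k))
      N∸2k≡1+2[n∸k] = ≡.trans (ℕₚ.+-∸-assoc 1 2k≤2n) (≡.cong suc (≡.sym (ℕₚ.*-distribˡ-∸ 2 n k)))

  signed-⊛-at-odd : ∀ (f g : Seq) (c : ℕ → Carrier) n →
    (∀ i → odd i ≡ true → f i ≈ 0#) → (∀ m → g (suc (2 ℕ.* m)) ≈ signed m (c m)) →
    signed n ((f ⊛ g) (suc (2 ℕ.* n))) ≈ Σ (λ k → signed k (qbinom q (suc (2 ℕ.* n)) (2 ℕ.* k) * f (2 ℕ.* k) * c (n ∸ k))) n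
  signed-⊛-at-odd f g c n f-odd≈0 g-odd≈±c = begin
    signed n ((f ⊛ g) (suc (2 ℕ.* n)))
      ≈⟨ signed-cong n (⊛-at-odd f g n f-odd≈0) ⟩
    signed n (Σ (λ k → Qf k * g (suc (2 ℕ.* (n ∸ k)))) n)
      ≈⟨ signed-Σ n (λ k → Qf k * g (suc (2 ℕ.* (n ∸ k)))) n ⟩
    Σ (λ k → signed n (Qf k * g (suc (2 ℕ.* (n ∸ k))))) n
      ≈⟨ Σ-cong n term ⟩
    Σ (λ k → signed k (Qf k * c (n ∸ k))) n ∎
    where
    Qf : ℕ → Carrier
    Qf k = qbinom q (suc (2 ℕ.* n)) (2 ℕ.* k) * f (2 ℕ.* k)
    term : ∀ k → k ≤ n → signed n (Qf k * g (suc (2 ℕ.* (n ∸ k)))) ≈ signed k (Qf k * c (n ∸ k))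
    term k k≤n = begin
      signed n (Qf k * g (suc (2 ℕ.* (n ∸ k))))     ≈⟨ signed-cong n (*-congˡ (g-odd≈±c (n ∸ k))) ⟩
      signed n (Qf k * signed (n ∸ k) (c (n ∸ k)))  ≈⟨ signed-cong n (signed-*ʳ (n ∸ k) _ _) ⟩
      signed n (signed (n ∸ k) (Qf k * c (n ∸ k)))  ≈⟨ signed-∸ n k k≤n _ ⟩
      signed k (Qf k * c (n ∸ k))                   ∎

module QTrigonometry {c ℓ} (R : CommutativeRing c ℓ) (q : CommutativeRing.Carrier R) where
  open CommutativeRing R using (_≈_; 0#; 1#; _+_; _*_; -_)
  open QNumbers R using (pow)
  open QExponentialSeries R q
  private
    module R = CommutativeRing R
    module S = CommutativeRing seqRing
    module Rˢ = IntegerCoefficientSolver R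
  open import Algebra.Properties.Ring R.ring using (-0#≈0#)
  open import Algebra.Properties.Group S.+-group using (x∙y⁻¹≈ε⇒x≈y; x≈y⇒x∙y⁻¹≈ε)
  open IntegerCoefficientSolver seqRing using (solve; _:=_; _:+_; _:*_; _:-_; :-_; :0; :1)
  open import Relation.Binary.Reasoning.Setoid S.setoid

  cosq sinq : Seq
  cosq zero = 1#
  cosq (suc n) = - sinq n
  sinq zero = 0#
  sinq (suc n) = cosq n

  -- negPochOdd carries the coefficients (-1)ᵐ(-q;q)₂ₘ of the theorem (negPochOdd-odd below). The
  -- system is chosen so that, with B = negPochOdd and C = negPochEven, B cos - C sin - sin and
  -- C cos + B sin satisfy D y = z, D z = -y with zero initial values, and hence vanish.
  negPochOdd negPochEven : Seq
  negPochOdd zero = 0#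
  negPochOdd (suc n) = 𝟙 n + negPochEven n + pow q n * negPochEven n
  negPochEven zero = 0#
  negPochEven (suc n) = - (negPochOdd n + pow q n * negPochOdd n)

  D≋rotation⇒≋𝟘 : ∀ f g → f 0 ≈ 0# → g 0 ≈ 0# → D f ≋ g → D g ≋ ⊖ f → ∀ n → f n ≈ 0# × g n ≈ 0#
  D≋rotation⇒≋𝟘 f g f₀≈0 g₀≈0 Df≋g Dg≋-f zero = f₀≈0 , g₀≈0
  D≋rotation⇒≋𝟘 f g f₀≈0 g₀≈0 Df≋g Dg≋-f (suc n) =
    let (fₙ≈0 , gₙ≈0) = D≋rotation⇒≋𝟘 f g f₀≈0 g₀≈0 Df≋g Dg≋-f n
    in R.trans (Df≋g n) gₙ≈0 , R.trans (Dg≋-f n) (R.trans (R.-‿cong fₙ≈0) -0#≈0#)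

  negPochOdd⊛[cos²+sin²]≋sin⊛cos : negPochOdd ⊛ (cosq ⊛ cosq ⊕ sinq ⊛ sinq) ≋ sinq ⊛ cosq
  negPochOdd⊛[cos²+sin²]≋sin⊛cos = begin
    B ⊛ (cosq ⊛ cosq ⊕ sinq ⊛ sinq)
      ≈⟨ solve 4 (λ b c co si → b :* (co :* co :+ si :* si) := si :* co :+ (b :* co :- c :* si :- si) :* co :+ (c :* co :+ b :* si) :* si)
                 S.refl B C cosq sinq ⟩
    sinq ⊛ cosq ⊕ Y ⊛ cosq ⊕ Z ⊛ sinq
      ≈⟨ S.+-cong (S.+-congˡ (⊛-congʳ cosq (λ n → proj₁ (Y,Z≈0 n)))) (⊛-congʳ sinq (λ n → proj₂ (Y,Z≈0 n))) ⟩
    sinq ⊛ cosq ⊕ 𝟘 ⊛ cosq ⊕ 𝟘 ⊛ sinq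
      ≈⟨ solve 2 (λ co si → si :* co :+ :0 :* co :+ :0 :* si := si :* co) S.refl cosq sinq ⟩
    sinq ⊛ cosq ∎
    where
    B C Y Z : Seq
    B = negPochOdd
    C = negPochEven
    Y = B ⊛ cosq ⊕ ⊖ (C ⊛ sinq) ⊕ ⊖ sinq
    Z = C ⊛ cosq ⊕ B ⊛ sinq
    DY≋Z : D Y ≋ Z
    DY≋Z = begin
      D Y
        ≈⟨ S.+-cong (S.+-cong (D-⊛ B cosq) (λ n → R.-‿cong (D-⊛ C sinq n))) S.refl ⟩
      (D B ⊛ cosq ⊕ dilate B ⊛ D cosq) ⊕ ⊖ (D C ⊛ sinq ⊕ dilate C ⊛ D sinq) ⊕ ⊖ D sinq
        ≈⟨ solve 6 (λ b db c dc co si → ((:1 :+ c :+ dc) :* co :+ db :* (:- si)) :+ (:- ((:- (b :+ db)) :* si :+ dc :* co)) :+ (:- co)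
                                        := c :* co :+ b :* si) S.refl B (dilate B) C (dilate C) cosq sinq ⟩
      Z ∎
    DZ≋-Y : D Z ≋ ⊖ Y
    DZ≋-Y = begin
      D Z
        ≈⟨ S.+-cong (D-⊛ C cosq) (D-⊛ B sinq) ⟩
      (D C ⊛ cosq ⊕ dilate C ⊛ D cosq) ⊕ (D B ⊛ sinq ⊕ dilate B ⊛ D sinq)
        ≈⟨ solve 6 (λ b db c dc co si → ((:- (b :+ db)) :* co :+ dc :* (:- si)) :+ ((:1 :+ c :+ dc) :* si :+ db :* co)
                                        := :- (b :* co :+ (:- (c :* si)) :+ (:- si))) S.refl B (dilate B) C (dilate C) cosq sinq ⟩
      ⊖ Y ∎
    Y,Z≈0 : ∀ n → Y n ≈ 0# × Z n ≈ 0#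
    Y,Z≈0 = D≋rotation⇒≋𝟘 Y Z
      (Rˢ.solve 0 (Rˢ.:1 Rˢ.:* Rˢ.:0 Rˢ.:* Rˢ.:1 Rˢ.:- Rˢ.:1 Rˢ.:* Rˢ.:0 Rˢ.:* Rˢ.:0 Rˢ.:- Rˢ.:0 Rˢ.:= Rˢ.:0) R.refl)
      (Rˢ.solve 0 (Rˢ.:1 Rˢ.:* Rˢ.:0 Rˢ.:* Rˢ.:1 Rˢ.:+ Rˢ.:1 Rˢ.:* Rˢ.:0 Rˢ.:* Rˢ.:0 Rˢ.:= Rˢ.:0) R.refl)
      DY≋Z DZ≋-Y

  cos⊛dilate-cos⊕dilate-sin⊛sin≋cos²+sin² : cosq ⊛ dilate cosq ⊕ dilate sinq ⊛ sinq ≋ cosq ⊛ cosq ⊕ sinq ⊛ sinq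
  cos⊛dilate-cos⊕dilate-sin⊛sin≋cos²+sin² = begin
    cosq ⊛ dilate cosq ⊕ dilate sinq ⊛ sinq
      ≈⟨ solve 4 (λ co dco si dsi → co :* dco :+ dsi :* si := co :* (co :- (co :- dco)) :+ (si :- (si :- dsi)) :* si)
                 S.refl cosq (dilate cosq) sinq (dilate sinq) ⟩
    cosq ⊛ (cosq ⊕ ⊖ (cosq ⊕ ⊖ dilate cosq)) ⊕ (sinq ⊕ ⊖ (sinq ⊕ ⊖ dilate sinq)) ⊛ sinq
      ≈⟨ S.+-cong (⊛-congˡ cosq (S.+-congˡ {cosq} (S.-‿cong (f-dilate≋X⊛D cosq))))
                  (⊛-congʳ sinq (S.+-congˡ {sinq} (S.-‿cong (f-dilate≋X⊛D sinq)))) ⟩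
    cosq ⊛ (cosq ⊕ ⊖ (X ⊛ ⊖ sinq)) ⊕ (sinq ⊕ ⊖ (X ⊛ cosq)) ⊛ sinq
      ≈⟨ solve 3 (λ co si x → co :* (co :- x :* (:- si)) :+ (si :- x :* co) :* si := co :* co :+ si :* si) S.refl cosq sinq X ⟩
    cosq ⊛ cosq ⊕ sinq ⊛ sinq ∎

  module _ (t s : Seq) (t₀≈0 : t 0 ≈ 0#) (s₀≈1 : s 0 ≈ 1#)
           (Dt≋1+dilate-t⊛t : D t ≋ 𝟙 ⊕ dilate t ⊛ t) (Ds≋dilate-s⊛t : D s ≋ dilate s ⊛ t) where

    t⊛cos≋sin : t ⊛ cosq ≋ sinq
    t⊛cos≋sin = x∙y⁻¹≈ε⇒x≈y (t ⊛ cosq) sinq (D≋⊛⇒≋𝟘 Z (dilate t) Z₀≈0 DZ≋dilate-t⊛Z)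
      where
      Z : Seq
      Z = t ⊛ cosq ⊕ ⊖ sinq
      Z₀≈0 : Z 0 ≈ 0#
      Z₀≈0 = R.trans (R.+-congʳ (R.*-congʳ (R.*-congˡ t₀≈0))) (Rˢ.solve 0 (Rˢ.:1 Rˢ.:* Rˢ.:0 Rˢ.:* Rˢ.:1 Rˢ.:- Rˢ.:0 Rˢ.:= Rˢ.:0) R.refl)
      DZ≋dilate-t⊛Z : D Z ≋ dilate t ⊛ Z
      DZ≋dilate-t⊛Z = begin
        D Z                                                ≈⟨ S.+-congʳ (D-⊛ t cosq) ⟩
        D t ⊛ cosq ⊕ dilate t ⊛ ⊖ sinq ⊕ ⊖ cosq            ≈⟨ S.+-congʳ (S.+-congʳ (⊛-congʳ cosq Dt≋1+dilate-t⊛t)) ⟩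
        (𝟙 ⊕ dilate t ⊛ t) ⊛ cosq ⊕ dilate t ⊛ ⊖ sinq ⊕ ⊖ cosq
          ≈⟨ solve 4 (λ dt t co si → (:1 :+ dt :* t) :* co :+ dt :* (:- si) :- co := dt :* (t :* co :- si)) S.refl (dilate t) t cosq sinq ⟩
        dilate t ⊛ Z                                       ∎

    s⊛cos≋𝟙 : s ⊛ cosq ≋ 𝟙
    s⊛cos≋𝟙 zero = R.trans (R.*-congʳ (R.trans (R.*-identityˡ _) s₀≈1)) (R.*-identityʳ _)
    s⊛cos≋𝟙 (suc n) = D[s⊛cos]≋𝟘 n
      where
      D[s⊛cos]≋𝟘 : D (s ⊛ cosq) ≋ 𝟘
      D[s⊛cos]≋𝟘 = begin
        D (s ⊛ cosq)                                ≈⟨ D-⊛ s cosq ⟩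
        D s ⊛ cosq ⊕ dilate s ⊛ ⊖ sinq              ≈⟨ S.+-congʳ (⊛-congʳ cosq Ds≋dilate-s⊛t) ⟩
        dilate s ⊛ t ⊛ cosq ⊕ dilate s ⊛ ⊖ sinq
          ≈⟨ solve 4 (λ ds t co si → ds :* t :* co :+ ds :* (:- si) := ds :* (t :* co :- si)) S.refl (dilate s) t cosq sinq ⟩
        dilate s ⊛ (t ⊛ cosq ⊕ ⊖ sinq)              ≈⟨ ⊛-congˡ (dilate s) (x≈y⇒x∙y⁻¹≈ε t⊛cos≋sin) ⟩
        dilate s ⊛ 𝟘                                ≈⟨ S.zeroʳ (dilate s) ⟩
        𝟘                                           ∎

    Dt⊛negPochOdd≋dilate-s⊛sin : D t ⊛ negPochOdd ≋ dilate s ⊛ sinq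
    Dt⊛negPochOdd≋dilate-s⊛sin = x∙y⁻¹≈ε⇒x≈y (D t ⊛ negPochOdd) (dilate s ⊛ sinq)
      (⊛≋𝟘⇒≋𝟘 G (D t ⊛ negPochOdd ⊕ ⊖ (dilate s ⊛ sinq)) G₀≈1 (begin
        G ⊛ (D t ⊛ negPochOdd ⊕ ⊖ (dilate s ⊛ sinq))
          ≈⟨ solve 3 (λ g l r → g :* (l :- r) := g :* l :- g :* r) S.refl G (D t ⊛ negPochOdd) (dilate s ⊛ sinq) ⟩
        G ⊛ (D t ⊛ negPochOdd) ⊕ ⊖ (G ⊛ (dilate s ⊛ sinq))
          ≈⟨ x≈y⇒x∙y⁻¹≈ε (S.trans G⊛lhs≋sin⊛cos (S.sym G⊛rhs≋sin⊛cos)) ⟩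
        𝟘 ∎))
      where
      G : Seq
      G = cosq ⊛ dilate cosq
      G₀≈1 : G 0 ≈ 1#
      G₀≈1 = Rˢ.solve 0 (Rˢ.:1 Rˢ.:* Rˢ.:1 Rˢ.:* (Rˢ.:1 Rˢ.:* Rˢ.:1) Rˢ.:= Rˢ.:1) R.refl
      dilate-t⊛dilate-cos≋dilate-sin : dilate t ⊛ dilate cosq ≋ dilate sinq
      dilate-t⊛dilate-cos≋dilate-sin = S.trans (S.sym (dilate-⊛ t cosq)) (dilate-cong t⊛cos≋sin)
      dilate-s⊛dilate-cos≋𝟙 : dilate s ⊛ dilate cosq ≋ 𝟙
      dilate-s⊛dilate-cos≋𝟙 = S.trans (S.sym (dilate-⊛ s cosq)) (S.trans (dilate-cong s⊛cos≋𝟙) dilate-𝟙)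
        where
        dilate-𝟙 : dilate 𝟙 ≋ 𝟙
        dilate-𝟙 zero = R.*-identityʳ _
        dilate-𝟙 (suc n) = R.zeroʳ _
      G⊛lhs≋sin⊛cos : G ⊛ (D t ⊛ negPochOdd) ≋ sinq ⊛ cosq
      G⊛lhs≋sin⊛cos = begin
        G ⊛ (D t ⊛ negPochOdd)
          ≈⟨ ⊛-congˡ G (⊛-congʳ negPochOdd Dt≋1+dilate-t⊛t) ⟩
        G ⊛ ((𝟙 ⊕ dilate t ⊛ t) ⊛ negPochOdd)
          ≈⟨ solve 6 (λ co dco dt t b si → co :* dco :* ((:1 :+ dt :* t) :* b) := b :* (co :* dco :+ (dt :* dco) :* (t :* co)))
                     S.refl cosq (dilate cosq) (dilate t) t negPochOdd sinq ⟩
        negPochOdd ⊛ (cosq ⊛ dilate cosq ⊕ (dilate t ⊛ dilate cosq) ⊛ (t ⊛ cosq))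
          ≈⟨ ⊛-congˡ negPochOdd (S.+-congˡ {cosq ⊛ dilate cosq} (⊛-cong dilate-t⊛dilate-cos≋dilate-sin t⊛cos≋sin)) ⟩
        negPochOdd ⊛ (cosq ⊛ dilate cosq ⊕ dilate sinq ⊛ sinq)
          ≈⟨ ⊛-congˡ negPochOdd cos⊛dilate-cos⊕dilate-sin⊛sin≋cos²+sin² ⟩
        negPochOdd ⊛ (cosq ⊛ cosq ⊕ sinq ⊛ sinq)
          ≈⟨ negPochOdd⊛[cos²+sin²]≋sin⊛cos ⟩
        sinq ⊛ cosq ∎
      G⊛rhs≋sin⊛cos : G ⊛ (dilate s ⊛ sinq) ≋ sinq ⊛ cosq
      G⊛rhs≋sin⊛cos = begin
        G ⊛ (dilate s ⊛ sinq)
          ≈⟨ solve 4 (λ co dco ds si → co :* dco :* (ds :* si) := (ds :* dco) :* (si :* co)) S.refl cosq (dilate cosq) (dilate s) sinq ⟩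
        (dilate s ⊛ dilate cosq) ⊛ (sinq ⊛ cosq)
          ≈⟨ ⊛-congʳ (sinq ⊛ cosq) dilate-s⊛dilate-cos≋𝟙 ⟩
        𝟙 ⊛ (sinq ⊛ cosq)
          ≈⟨ ⊛-identityˡ (sinq ⊛ cosq) ⟩
        sinq ⊛ cosq ∎

module Permutations where
  open import Data.Nat using (_<?_; _<ᵇ_)
  open import Data.Bool using (Bool; true; false; if_then_else_; not; _∧_; T)
  open import Data.Bool.Properties using (∧-assoc)
  open import Data.List using (List; []; _∷_; _++_; map; filter; length; upTo)
  open import Data.List.Properties using (length-++; length-map; length-upTo; filter-++; filter-accept; filter-reject)
  open import Data.List.Relation.Unary.All as All using (All; []; _∷_)
  import Data.List.Relation.Unary.All.Properties as All
  open import Data.List.Relation.Unary.AllPairs using (AllPairs; []; _∷_)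
  import Data.List.Relation.Unary.AllPairs.Properties as AllPairs
  open import Data.List.Relation.Binary.Permutation.Propositional using (_↭_; ↭-refl; ↭-prep; ↭-swap; ↭-trans)
  import Data.List.Relation.Binary.Permutation.Propositional as ↭
  open import Data.List.Relation.Binary.Permutation.Propositional.Properties using (↭-length; filter-↭)
  open import Data.Empty using (⊥-elim)
  open import Data.Nat.Tactic.RingSolver using (solve-∀)
  open import Algebra.Properties.CommutativeSemigroup ℕₚ.+-commutativeSemigroup using (x∙yz≈y∙xz)

  insertions-↭ : ∀ x τ → All (_↭ x ∷ τ) (insertions x τ)
  insertions-↭ x [] = ↭-refl ∷ []
  insertions-↭ x (y ∷ ys) = ↭-refl ∷ All.map⁺ (All.map (λ p → ↭-trans (↭-prep y p) (↭-swap y x ↭-refl)) (insertions-↭ x ys))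

  perms-↭ : ∀ xs → All (_↭ xs) (perms xs)
  perms-↭ [] = ↭-refl ∷ []
  perms-↭ (x ∷ xs) =
    All.concat⁺ (All.map⁺ (All.map (λ τ↭xs → All.map (λ p → ↭-trans p (↭-prep x τ↭xs)) (insertions-↭ x _)) (perms-↭ xs)))

  perms-length : ∀ xs → All (λ σ → length σ ≡ length xs) (perms xs)
  perms-length xs = All.map ↭-length (perms-↭ xs)

  length-oneTo : ∀ n → length (oneTo n) ≡ n
  length-oneTo n = ≡.trans (length-map suc (upTo n)) (length-upTo n)

  oneTo-increasing : ∀ n → AllPairs _<_ (oneTo n)
  oneTo-increasing n = AllPairs.map⁺ (AllPairs.applyUpTo⁺₁ (λ i → i) n (λ i<j _ → s≤s i<j))

  Split : Set
  Split = List ℕ × List ℕ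

  consˡ consʳ : ℕ → Split → Split
  consˡ x (a , b) = (x ∷ a , b)
  consʳ x (a , b) = (a , x ∷ b)

  splits : ℕ → List ℕ → List Split
  splits zero xs = ([] , xs) ∷ []
  splits (suc k) [] = []
  splits (suc k) (x ∷ xs) = map (consˡ x) (splits k xs) ++ map (consʳ x) (splits (suc k) xs)

  splits-tooMany : ∀ xs k → length xs < k → splits k xs ≡ []
  splits-tooMany [] (suc k) _ = ≡.refl
  splits-tooMany (x ∷ xs) (suc k) (s≤s lt)
    rewrite splits-tooMany xs k lt | splits-tooMany xs (suc k) (ℕₚ.m<n⇒m<1+n lt) = ≡.refl

  splits-all : ∀ xs → splits (length xs) xs ≡ (xs , []) ∷ []
  splits-all [] = ≡.refl
  splits-all (x ∷ xs) rewrite splits-all xs | splits-tooMany xs (suc (length xs)) ℕₚ.≤-refl = ≡.refl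

  splits-length : ∀ k xs → All (λ (a , b) → length a ≡ k × length a ℕ.+ length b ≡ length xs) (splits k xs)
  splits-length zero xs = (≡.refl , ≡.refl) ∷ []
  splits-length (suc k) [] = []
  splits-length (suc k) (x ∷ xs) = All.++⁺
    (All.map⁺ (All.map (λ (e , e′) → ≡.cong suc e , ≡.cong suc e′) (splits-length k xs)))
    (All.map⁺ (All.map (λ {(a , b)} (e , e′) → e , ≡.trans (ℕₚ.+-suc (length a) (length b)) (≡.cong suc e′)) (splits-length (suc k) xs)))

  splits-All : ∀ {P : ℕ → Set} k xs → All P xs → All (λ (a , b) → All P a × All P b) (splits k xs)
  splits-All zero xs pxs = ([] , pxs) ∷ []
  splits-All (suc k) [] pxs = []
  splits-All (suc k) (x ∷ xs) (px ∷ pxs) = All.++⁺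
    (All.map⁺ (All.map (λ (pa , pb) → px ∷ pa , pb) (splits-All k xs pxs)))
    (All.map⁺ (All.map (λ (pa , pb) → pa , px ∷ pb) (splits-All (suc k) xs pxs)))

  splits-increasing : ∀ k xs → AllPairs _<_ xs → All (λ (a , b) → AllPairs _<_ a × AllPairs _<_ b) (splits k xs)
  splits-increasing zero xs inc = ([] , inc) ∷ []
  splits-increasing (suc k) [] inc = []
  splits-increasing (suc k) (x ∷ xs) (x<xs ∷ inc) = All.++⁺
    (All.map⁺ (All.zipWith (λ ((ia , ib) , (x<a , _)) → x<a ∷ ia , ib) (splits-increasing k xs inc , splits-All k xs x<xs)))
    (All.map⁺ (All.zipWith (λ ((ia , ib) , (_ , x<b)) → ia , x<b ∷ ib) (splits-increasing (suc k) xs inc , splits-All (suc k) xs x<xs)))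

  smaller : ℕ → List ℕ → ℕ
  smaller y v = length (filter (_<? y) v)

  crossInv : List ℕ → List ℕ → ℕ
  crossInv [] v = 0
  crossInv (y ∷ u) v = smaller y v ℕ.+ crossInv u v

  smaller-++ : ∀ y u v → smaller y (u ++ v) ≡ smaller y u ℕ.+ smaller y v
  smaller-++ y u v = ≡.trans (≡.cong length (filter-++ (_<? y) u v)) (length-++ (filter (_<? y) u))

  smaller-none : ∀ x β → All (x <_) β → smaller x β ≡ 0
  smaller-none x [] [] = ≡.refl
  smaller-none x (y ∷ β) (x<y ∷ x<β) = ≡.trans (≡.cong length (filter-reject (_<? x) (ℕₚ.<-asym x<y))) (smaller-none x β x<β)

  smaller-↭ : ∀ y {v v′} → v ↭ v′ → smaller y v ≡ smaller y v′
  smaller-↭ y p = ↭-length (filter-↭ (_<? y) p)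

  inv-++ : ∀ u v → inv (u ++ v) ≡ inv u ℕ.+ inv v ℕ.+ crossInv u v
  inv-++ [] v = ≡.sym (ℕₚ.+-identityʳ (inv v))
  inv-++ (y ∷ u) v = ≡.trans (≡.cong₂ ℕ._+_ (smaller-++ y u v) (inv-++ u v)) (regroup (smaller y u) (smaller y v) (inv u) (inv v) (crossInv u v))
    where
    regroup : ∀ a b c d e → a ℕ.+ b ℕ.+ (c ℕ.+ d ℕ.+ e) ≡ a ℕ.+ c ℕ.+ d ℕ.+ (b ℕ.+ e)
    regroup = solve-∀

  crossInv-min : ∀ x α β → All (x <_) α → crossInv α (x ∷ β) ≡ length α ℕ.+ crossInv α β
  crossInv-min x [] β [] = ≡.refl
  crossInv-min x (y ∷ α) β (x<y ∷ x<α) rewrite filter-accept (_<? y) {x} {β} x<y | crossInv-min x α β x<α =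
    regroup (smaller y β) (length α) (crossInv α β)
    where
    regroup : ∀ a b c → suc a ℕ.+ (b ℕ.+ c) ≡ suc b ℕ.+ (a ℕ.+ c)
    regroup = solve-∀

  inv-insert-min : ∀ x α β → All (x <_) α → All (x <_) β → inv (α ++ x ∷ β) ≡ inv α ℕ.+ inv β ℕ.+ length α ℕ.+ crossInv α β
  inv-insert-min x α β x<α x<β rewrite inv-++ α (x ∷ β) | smaller-none x β x<β | crossInv-min x α β x<α =
    regroup (inv α) (inv β) (length α) (crossInv α β)
    where
    regroup : ∀ a b c d → a ℕ.+ b ℕ.+ (c ℕ.+ d) ≡ a ℕ.+ b ℕ.+ c ℕ.+ d
    regroup = solve-∀

  crossInv-↭ʳ : ∀ u {v v′} → v ↭ v′ → crossInv u v ≡ crossInv u v′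
  crossInv-↭ʳ [] p = ≡.refl
  crossInv-↭ʳ (y ∷ u) p = ≡.cong₂ ℕ._+_ (smaller-↭ y p) (crossInv-↭ʳ u p)

  crossInv-↭ˡ : ∀ {u u′} v → u ↭ u′ → crossInv u v ≡ crossInv u′ v
  crossInv-↭ˡ v ↭.refl = ≡.refl
  crossInv-↭ˡ v (↭.prep x p) = ≡.cong (smaller x v ℕ.+_) (crossInv-↭ˡ v p)
  crossInv-↭ˡ v (↭.swap x y p) rewrite crossInv-↭ˡ v p = x∙yz≈y∙xz (smaller x v) (smaller y v) _
  crossInv-↭ˡ v (↭.trans p p′) = ≡.trans (crossInv-↭ˡ v p) (crossInv-↭ˡ v p′)

  flips : Bool → ℕ → Bool
  flips d zero = d
  flips d (suc i) = flips (not d) i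

  -- Whether the minimum may sit after i and before j other entries of a permutation whose
  -- first adjacent pair descends iff d: it has to end a descent and start an ascent.
  minFits : Bool → ℕ → ℕ → Bool
  minFits d zero zero = true
  minFits d zero (suc _) = not d
  minFits d (suc i) _ = flips d i

  <⇒<ᵇ≡true : ∀ {x y} → x < y → (x <ᵇ y) ≡ true
  <⇒<ᵇ≡true {x} {y} x<y with x <ᵇ y | ℕₚ.<⇒<ᵇ x<y
  ... | true | _ = ≡.refl

  <⇒>ᵇ≡false : ∀ {x y} → x < y → (y <ᵇ x) ≡ false
  <⇒>ᵇ≡false {x} {y} x<y with y <ᵇ x in eq
  ... | false = ≡.refl
  ... | true = ⊥-elim (ℕₚ.<-asym x<y (ℕₚ.<ᵇ⇒< y x (≡.subst T (≡.sym eq) _)))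

  alt-min∷ : ∀ d x β → All (x <_) β → alt d (x ∷ β) ≡ minFits d 0 (length β) ∧ alt true β
  alt-min∷ d x [] [] = ≡.refl
  alt-min∷ true x (y ∷ β) (x<y ∷ _) rewrite <⇒>ᵇ≡false x<y = ≡.refl
  alt-min∷ false x (y ∷ β) (x<y ∷ _) rewrite <⇒<ᵇ≡true x<y = ≡.refl

  alt-insert-min : ∀ d x α β → All (x <_) α → All (x <_) β →
                   alt d (α ++ x ∷ β) ≡ alt d α ∧ minFits d (length α) (length β) ∧ alt true β
  alt-insert-min d x [] β _ x<β = alt-min∷ d x β x<β
  alt-insert-min true x (a ∷ []) β (x<a ∷ []) x<β rewrite <⇒<ᵇ≡true x<a | alt-min∷ false x β x<β with β
  ... | [] = ≡.refl
  ... | _ ∷ _ = ≡.refl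
  alt-insert-min false x (a ∷ []) β (x<a ∷ []) x<β rewrite <⇒>ᵇ≡false x<a = ≡.refl
  alt-insert-min d x (a ∷ a′ ∷ α) β (_ ∷ x<α) x<β rewrite alt-insert-min (not d) x (a′ ∷ α) β x<α x<β =
    ≡.sym (∧-assoc (if d then a′ <ᵇ a else a <ᵇ a′) (alt (not d) (a′ ∷ α)) _)

module AlternatingPermutations {c ℓ} (R : CommutativeRing c ℓ) (q : CommutativeRing.Carrier R) where
  open import Data.Nat.Induction using (<-rec)
  open import Data.Bool using (Bool; true; false; if_then_else_; _∧_)
  open import Data.List using (List; []; _∷_; _++_; map; concatMap; length; take; drop; applyUpTo)
  open import Data.List.Properties using (take-all; drop-all)
  open import Data.List.Relation.Unary.All as All using (All; []; _∷_)
  open import Data.List.Relation.Unary.AllPairs using (AllPairs; []; _∷_)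
  open import Data.List.Relation.Binary.Permutation.Propositional using (_↭_; ↭-sym)
  open import Data.List.Relation.Binary.Permutation.Propositional.Properties using (↭-length; All-resp-↭)
  open import Data.Sum using (inj₁; inj₂)
  open CommutativeRing R hiding (zero)
  open QNumbers R
  open FiniteSums R
  open Permutations
  open IntegerCoefficientSolver R using (solve; _:=_; _:*_)
  open import Relation.Binary.Reasoning.Setoid setoid

  Σˡ-insertions : ∀ (f : List ℕ → Carrier) x τ → Σˡ f (insertions x τ) ≈ Σ (λ i → f (take i τ ++ x ∷ drop i τ)) (length τ)
  Σˡ-insertions f x [] = +-identityʳ _
  Σˡ-insertions f x (y ∷ ys) = +-congˡ (trans (Σˡ-map f (y ∷_) (insertions x ys)) (Σˡ-insertions (λ ρ → f (y ∷ ρ)) x ys))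

  Σˡ-insertions-split : ∀ x τ k (F : List ℕ → List ℕ → Carrier) → suc k ≤ length τ →
    Σˡ (λ ρ → F (take (suc k) ρ) (drop (suc k) ρ)) (insertions x τ)
    ≈ Σˡ (λ ρ → F ρ (drop k τ)) (insertions x (take k τ)) + Σˡ (λ ρ → F (take (suc k) τ) ρ) (insertions x (drop (suc k) τ))
  Σˡ-insertions-split x (y ∷ ys) zero F _ = trans (+-congˡ (Σˡ-map _ (y ∷_) (insertions x ys))) (+-congʳ (sym (+-identityʳ _)))
  Σˡ-insertions-split x (y ∷ ys) (suc k) F (s≤s k<) = begin
    F (x ∷ y ∷ take k ys) (drop k ys) + Σˡ (λ ρ → F (take (2 ℕ.+ k) ρ) (drop (2 ℕ.+ k) ρ)) (map (y ∷_) (insertions x ys))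
      ≈⟨ +-congˡ (Σˡ-map _ (y ∷_) (insertions x ys)) ⟩
    F (x ∷ y ∷ take k ys) (drop k ys) + Σˡ (λ ρ → F (y ∷ take (suc k) ρ) (drop (suc k) ρ)) (insertions x ys)
      ≈⟨ +-congˡ (Σˡ-insertions-split x ys k (λ a b → F (y ∷ a) b) k<) ⟩
    F (x ∷ y ∷ take k ys) (drop k ys) + (front + back)
      ≈⟨ +-assoc _ _ _ ⟨
    (F (x ∷ y ∷ take k ys) (drop k ys) + front) + back
      ≈⟨ +-congʳ (+-congˡ (Σˡ-map _ (y ∷_) (insertions x (take k ys)))) ⟨
    Σˡ (λ ρ → F ρ (drop k ys)) (insertions x (y ∷ take k ys)) + back ∎
    where
    front back : Carrier
    front = Σˡ (λ ρ → F (y ∷ ρ) (drop k ys)) (insertions x (take k ys))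
    back = Σˡ (λ ρ → F (y ∷ take (suc k) ys) ρ) (insertions x (drop (suc k) ys))

  Σ-perms² : (List ℕ → List ℕ → Carrier) → Split → Carrier
  Σ-perms² F (a , b) = Σˡ (λ α → Σˡ (F α) (perms b)) (perms a)

  Σˡ-perms-take-drop : ∀ xs k (F : List ℕ → List ℕ → Carrier) → k ≤ length xs →
    Σˡ (λ σ → F (take k σ) (drop k σ)) (perms xs) ≈ Σˡ (Σ-perms² F) (splits k xs)
  Σˡ-perms-take-drop xs zero F _ = sym (trans (+-identityʳ _) (+-identityʳ _))
  Σˡ-perms-take-drop (x ∷ xs) (suc k) F (s≤s k≤) with ℕₚ.m≤n⇒m<n∨m≡n k≤
  ... | inj₁ k< = begin
    Σˡ (λ σ → F (take (suc k) σ) (drop (suc k) σ)) (concatMap (insertions x) (perms xs))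
      ≈⟨ Σˡ-concatMap _ (insertions x) (perms xs) ⟩
    Σˡ (λ τ → Σˡ (λ σ → F (take (suc k) σ) (drop (suc k) σ)) (insertions x τ)) (perms xs)
      ≈⟨ Σˡ-congᴬ (All.map (λ {τ} e → Σˡ-insertions-split x τ k F (≡.subst (suc k ≤_) (≡.sym e) k<)) (perms-length xs)) ⟩
    Σˡ (λ τ → G₁ (take k τ) (drop k τ) + G₂ (take (suc k) τ) (drop (suc k) τ)) (perms xs)
      ≈⟨ Σˡ-+ _ _ (perms xs) ⟩
    Σˡ (λ τ → G₁ (take k τ) (drop k τ)) (perms xs) + Σˡ (λ τ → G₂ (take (suc k) τ) (drop (suc k) τ)) (perms xs)
      ≈⟨ +-cong (Σˡ-perms-take-drop xs k G₁ k≤) (Σˡ-perms-take-drop xs (suc k) G₂ k<) ⟩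
    Σˡ (Σ-perms² G₁) (splits k xs) + Σˡ (Σ-perms² G₂) (splits (suc k) xs)
      ≈⟨ +-cong (trans (Σˡ-map (Σ-perms² F) _ (splits k xs)) (Σˡ-cong (splits k xs) moveˡ))
                (trans (Σˡ-map (Σ-perms² F) _ (splits (suc k) xs)) (Σˡ-cong (splits (suc k) xs) moveʳ)) ⟨
    Σˡ (Σ-perms² F) (map (consˡ x) (splits k xs)) + Σˡ (Σ-perms² F) (map (consʳ x) (splits (suc k) xs))
      ≈⟨ Σˡ-++ (Σ-perms² F) (map (consˡ x) (splits k xs)) (map (consʳ x) (splits (suc k) xs)) ⟨
    Σˡ (Σ-perms² F) (splits (suc k) (x ∷ xs)) ∎
    where
    G₁ G₂ : List ℕ → List ℕ → Carrier
    G₁ a b = Σˡ (λ ρ → F ρ b) (insertions x a)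
    G₂ a b = Σˡ (F a) (insertions x b)
    moveˡ : ∀ p → Σ-perms² F (consˡ x p) ≈ Σ-perms² G₁ p
    moveˡ (a , b) = begin
      Σˡ (λ α → Σˡ (F α) (perms b)) (concatMap (insertions x) (perms a))
        ≈⟨ Σˡ-concatMap _ (insertions x) (perms a) ⟩
      Σˡ (λ α′ → Σˡ (λ ρ → Σˡ (F ρ) (perms b)) (insertions x α′)) (perms a)
        ≈⟨ Σˡ-cong (perms a) (λ α′ → Σˡ-comm F (insertions x α′) (perms b)) ⟩
      Σ-perms² G₁ (a , b) ∎
    moveʳ : ∀ p → Σ-perms² F (consʳ x p) ≈ Σ-perms² G₂ p
    moveʳ (a , b) = Σˡ-cong (perms a) (λ α → Σˡ-concatMap (F α) (insertions x) (perms b))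
  ... | inj₂ ≡.refl = begin
    Σˡ (λ σ → F (take (suc k) σ) (drop (suc k) σ)) (perms (x ∷ xs))
      ≈⟨ Σˡ-congᴬ (All.map (λ {σ} e → reflexive (≡.cong₂ F (take-all (suc k) σ (ℕₚ.≤-reflexive e))
                                                            (drop-all (suc k) σ (ℕₚ.≤-reflexive e))))
                           (perms-length (x ∷ xs))) ⟩
    Σˡ (λ σ → F σ []) (perms (x ∷ xs))
      ≈⟨ trans (+-identityʳ _) (Σˡ-cong (perms (x ∷ xs)) (λ α → +-identityʳ _)) ⟨
    Σˡ (Σ-perms² F) ((x ∷ xs , []) ∷ [])
      ≡⟨ ≡.cong (Σˡ (Σ-perms² F)) (≡.cong₂ _++_ (≡.cong (map _) (splits-all xs))
                                                (≡.cong (map _) (splits-tooMany xs (suc (length xs)) ℕₚ.≤-refl))) ⟨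
    Σˡ (Σ-perms² F) (splits (suc k) (x ∷ xs)) ∎

  crossWeight : Split → Carrier
  crossWeight (a , b) = pow q (crossInv a b)

  Σˡ-crossWeight-splits : ∀ k xs → AllPairs _<_ xs → Σˡ crossWeight (splits k xs) ≈ qbinom q (length xs) k
  Σˡ-crossWeight-splits zero xs _ = +-identityʳ _
  Σˡ-crossWeight-splits (suc k) [] _ = refl
  Σˡ-crossWeight-splits (suc k) (x ∷ xs) (x<xs ∷ inc) = begin
    Σˡ crossWeight (map (consˡ x) (splits k xs) ++ map (consʳ x) (splits (suc k) xs))
      ≈⟨ Σˡ-++ crossWeight (map (consˡ x) (splits k xs)) (map (consʳ x) (splits (suc k) xs)) ⟩
    Σˡ crossWeight (map (consˡ x) (splits k xs)) + Σˡ crossWeight (map (consʳ x) (splits (suc k) xs))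
      ≈⟨ +-cong (Σˡ-map crossWeight (consˡ x) (splits k xs)) (Σˡ-map crossWeight (consʳ x) (splits (suc k) xs)) ⟩
    Σˡ (λ p → crossWeight (consˡ x p)) (splits k xs) + Σˡ (λ p → crossWeight (consʳ x p)) (splits (suc k) xs)
      ≈⟨ +-cong (Σˡ-congᴬ (All.map x-first (splits-All k xs x<xs)))
                (Σˡ-congᴬ (All.zipWith x-last (splits-All (suc k) xs x<xs , splits-length (suc k) xs))) ⟩
    Σˡ crossWeight (splits k xs) + Σˡ (λ p → pow q (suc k) * crossWeight p) (splits (suc k) xs)
      ≈⟨ +-congˡ (*-distribˡ-Σˡ (pow q (suc k)) crossWeight (splits (suc k) xs)) ⟨
    Σˡ crossWeight (splits k xs) + pow q (suc k) * Σˡ crossWeight (splits (suc k) xs)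
      ≈⟨ +-cong (Σˡ-crossWeight-splits k xs inc) (*-congˡ (Σˡ-crossWeight-splits (suc k) xs inc)) ⟩
    qbinom q (length xs) k + pow q (suc k) * qbinom q (length xs) (suc k) ∎
    where
    x-first : ∀ {p} → All (x <_) (proj₁ p) × All (x <_) (proj₂ p) → crossWeight (consˡ x p) ≈ crossWeight p
    x-first {a , b} (_ , x<b) = reflexive (≡.cong (λ m → pow q (m ℕ.+ crossInv a b)) (smaller-none x b x<b))
    x-last : ∀ {p} → (All (x <_) (proj₁ p) × All (x <_) (proj₂ p)) × (length (proj₁ p) ≡ suc k × length (proj₁ p) ℕ.+ length (proj₂ p) ≡ length xs) →
             crossWeight (consʳ x p) ≈ pow q (suc k) * crossWeight p
    x-last {a , b} ((x<a , _) , (|a|≡1+k , _)) =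
      trans (reflexive (≡.cong (pow q) (≡.trans (crossInv-min x a b x<a) (≡.cong (ℕ._+ crossInv a b) |a|≡1+k))))
            (pow-+ q (suc k) (crossInv a b))

  ind : Bool → Carrier
  ind b = if b then 1# else 0#

  ind-∧ : ∀ a b → ind (a ∧ b) ≈ ind a * ind b
  ind-∧ true b = sym (*-identityˡ _)
  ind-∧ false b = sym (zeroˡ _)

  weight : Bool → List ℕ → Carrier
  weight d σ = ind (alt d σ) * pow q (inv σ)

  weightSum : Bool → List ℕ → Carrier
  weightSum d xs = Σˡ (weight d) (perms xs)

  minWeight : Bool → Split → Carrier
  minWeight d (α , β) = pow q (length α) * ind (minFits d (length α) (length β)) * pow q (crossInv α β)

  minWeight-↭ : ∀ {d α a β b} → α ↭ a → β ↭ b → minWeight d (α , β) ≈ minWeight d (a , b)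
  minWeight-↭ {d} {α} {a} {β} {b} α↭a β↭b
    rewrite ↭-length α↭a | ↭-length β↭b | crossInv-↭ˡ β α↭a | crossInv-↭ʳ a β↭b = refl

  weight-insert-min : ∀ d x α β → All (x <_) α → All (x <_) β → weight d (α ++ x ∷ β) ≈ minWeight d (α , β) * weight d α * weight true β
  weight-insert-min d x α β x<α x<β = begin
    ind (alt d (α ++ x ∷ β)) * pow q (inv (α ++ x ∷ β))
      ≈⟨ reflexive (≡.cong₂ (λ b n → ind b * pow q n) (alt-insert-min d x α β x<α x<β) (inv-insert-min x α β x<α x<β)) ⟩
    ind (alt d α ∧ fits ∧ alt true β) * pow q (inv α ℕ.+ inv β ℕ.+ length α ℕ.+ crossInv α β)
      ≈⟨ *-cong (trans (ind-∧ _ _) (*-congˡ (ind-∧ _ _)))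
                (trans (pow-+ q (inv α ℕ.+ inv β ℕ.+ length α) (crossInv α β))
                       (*-congʳ (trans (pow-+ q (inv α ℕ.+ inv β) (length α)) (*-congʳ (pow-+ q (inv α) (inv β)))))) ⟩
    (ind (alt d α) * (ind fits * ind (alt true β))) * (((pow q (inv α) * pow q (inv β)) * pow q (length α)) * pow q (crossInv α β))
      ≈⟨ solve 7 (λ a f b pa pb pl pc → (a :* (f :* b)) :* (((pa :* pb) :* pl) :* pc) := pl :* f :* pc :* (a :* pa) :* (b :* pb))
                 refl _ _ _ _ _ _ _ ⟩
    minWeight d (α , β) * weight d α * weight true β ∎
    where
    fits : Bool
    fits = minFits d (length α) (length β)

  splitWeight : Bool → Split → Carrier
  splitWeight d (a , b) = minWeight d (a , b) * weightSum d a * weightSum true b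

  Σ-perms²-weight-insert-min : ∀ d x a b → All (x <_) a → All (x <_) b →
    Σ-perms² (λ α β → weight d (α ++ x ∷ β)) (a , b) ≈ splitWeight d (a , b)
  Σ-perms²-weight-insert-min d x a b x<a x<b = begin
    Σˡ (λ α → Σˡ (λ β → weight d (α ++ x ∷ β)) (perms b)) (perms a)
      ≈⟨ Σˡ-congᴬ (All.map (λ α↭a → Σˡ-congᴬ (All.map (λ β↭b → term α↭a β↭b) (perms-↭ b))) (perms-↭ a)) ⟩
    Σˡ (λ α → Σˡ (λ β → minWeight d (a , b) * weight d α * weight true β) (perms b)) (perms a)
      ≈⟨ Σˡ-cong (perms a) (λ α → *-distribˡ-Σˡ (minWeight d (a , b) * weight d α) (weight true) (perms b)) ⟨
    Σˡ (λ α → minWeight d (a , b) * weight d α * weightSum true b) (perms a)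
      ≈⟨ *-distribʳ-Σˡ (weightSum true b) (λ α → minWeight d (a , b) * weight d α) (perms a) ⟨
    Σˡ (λ α → minWeight d (a , b) * weight d α) (perms a) * weightSum true b
      ≈⟨ *-congʳ (*-distribˡ-Σˡ (minWeight d (a , b)) (weight d) (perms a)) ⟨
    minWeight d (a , b) * weightSum d a * weightSum true b ∎
    where
    term : ∀ {α β} → α ↭ a → β ↭ b → weight d (α ++ x ∷ β) ≈ minWeight d (a , b) * weight d α * weight true β
    term {α} {β} α↭a β↭b = trans (weight-insert-min d x α β (All-resp-↭ (↭-sym α↭a) x<a) (All-resp-↭ (↭-sym β↭b) x<b))
      (*-congʳ (*-congʳ (minWeight-↭ α↭a β↭b)))

  -- Sort the permutations of x ∷ xs by the position i of the minimum x, and record which entries come before it.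
  weightSum-min∷ : ∀ d x xs → All (x <_) xs →
    weightSum d (x ∷ xs) ≈ Σ (λ i → Σˡ (splitWeight d) (splits i xs)) (length xs)
  weightSum-min∷ d x xs x<xs = begin
    Σˡ (weight d) (concatMap (insertions x) (perms xs))
      ≈⟨ Σˡ-concatMap (weight d) (insertions x) (perms xs) ⟩
    Σˡ (λ τ → Σˡ (weight d) (insertions x τ)) (perms xs)
      ≈⟨ Σˡ-congᴬ (All.map (λ {τ} |τ|≡|xs| → trans (Σˡ-insertions (weight d) x τ) (reflexive (≡.cong (Σ (insert-at τ)) |τ|≡|xs|)))
                           (perms-length xs)) ⟩
    Σˡ (λ τ → Σ (insert-at τ) (length xs)) (perms xs)
      ≈⟨ Σˡ-Σ-comm insert-at (perms xs) (length xs) ⟩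
    Σ (λ i → Σˡ (λ τ → insert-at τ i) (perms xs)) (length xs)
      ≈⟨ Σ-cong (length xs) (λ i i≤ → Σˡ-perms-take-drop xs i (λ α β → weight d (α ++ x ∷ β)) i≤) ⟩
    Σ (λ i → Σˡ (Σ-perms² (λ α β → weight d (α ++ x ∷ β))) (splits i xs)) (length xs)
      ≈⟨ Σ-cong′ (length xs) (λ i → Σˡ-congᴬ (All.map (λ {(a , b)} (x<a , x<b) → Σ-perms²-weight-insert-min d x a b x<a x<b)
                                                     (splits-All i xs x<xs))) ⟩
    Σ (λ i → Σˡ (splitWeight d) (splits i xs)) (length xs) ∎
    where
    insert-at : List ℕ → ℕ → Carrier
    insert-at τ i = weight d (take i τ ++ x ∷ drop i τ)

  altSum : Bool → ℕ → Carrier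
  altSum d n = weightSum d (oneTo n)

  minSummand : Bool → ℕ → ℕ → Carrier
  minSummand d n i = pow q i * ind (minFits d i (n ∸ i)) * altSum d i * altSum true (n ∸ i) * qbinom q n i

  minRecurrence : Bool → ℕ → Carrier
  minRecurrence d n = Σ (minSummand d n) n

  RelabelInvariant : ℕ → Set ℓ
  RelabelInvariant n = ∀ d ys → AllPairs _<_ ys → length ys ≡ n → weightSum d ys ≈ altSum d n

  weightSum-min∷-recurrence : ∀ n → (∀ {m} → m ≤ n → RelabelInvariant m) →
    ∀ d x xs → AllPairs _<_ (x ∷ xs) → length xs ≡ n → weightSum d (x ∷ xs) ≈ minRecurrence d n
  weightSum-min∷-recurrence n relabel d x xs (x<xs ∷ inc) ≡.refl = trans (weightSum-min∷ d x xs x<xs) (Σ-cong n Σˡ-splits)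
    where
    Σˡ-splits : ∀ i → i ≤ n → Σˡ (splitWeight d) (splits i xs) ≈ minSummand d n i
    Σˡ-splits i i≤n = begin
      Σˡ (splitWeight d) (splits i xs)
        ≈⟨ Σˡ-congᴬ (All.zipWith split (splits-length i xs , splits-increasing i xs inc)) ⟩
      Σˡ (λ p → C * crossWeight p) (splits i xs)
        ≈⟨ *-distribˡ-Σˡ C crossWeight (splits i xs) ⟨
      C * Σˡ crossWeight (splits i xs)
        ≈⟨ *-congˡ (Σˡ-crossWeight-splits i xs inc) ⟩
      C * qbinom q n i ∎
      where
      C : Carrier
      C = pow q i * ind (minFits d i (n ∸ i)) * altSum d i * altSum true (n ∸ i)
      split : ∀ {p} → (length (proj₁ p) ≡ i × length (proj₁ p) ℕ.+ length (proj₂ p) ≡ n)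
                    × (AllPairs _<_ (proj₁ p) × AllPairs _<_ (proj₂ p)) →
              splitWeight d p ≈ C * crossWeight p
      split {a , b} ((|a|≡i , |a|+|b|≡n) , (inc-a , inc-b)) = begin
        minWeight d (a , b) * weightSum d a * weightSum true b
          ≈⟨ *-cong (*-cong (*-congʳ (reflexive (≡.cong₂ (λ k m → pow q k * ind (minFits d k m)) |a|≡i |b|≡n∸i)))
                            (relabel i≤n d a inc-a |a|≡i))
                    (relabel (ℕₚ.m∸n≤m n i) true b inc-b |b|≡n∸i) ⟩
        pow q i * ind (minFits d i (n ∸ i)) * pow q (crossInv a b) * altSum d i * altSum true (n ∸ i)
          ≈⟨ solve 5 (λ a₁ a₂ a₃ a₄ a₅ → a₁ :* a₂ :* a₃ :* a₄ :* a₅ := a₁ :* a₂ :* a₄ :* a₅ :* a₃) refl _ _ _ _ _ ⟩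
        C * crossWeight (a , b) ∎
        where
        |b|≡n∸i : length b ≡ n ∸ i
        |b|≡n∸i = ≡.trans (≡.sym (ℕₚ.m+n∸m≡n (length a) (length b))) (≡.cong₂ _∸_ |a|+|b|≡n |a|≡i)

  altSum-suc-relabel : ∀ n → (∀ {m} → m ≤ n → RelabelInvariant m) → ∀ d → altSum d (suc n) ≈ minRecurrence d n
  altSum-suc-relabel n relabel d = weightSum-min∷-recurrence n relabel d 1 (map suc (applyUpTo suc n))
    (oneTo-increasing (suc n)) (ℕₚ.suc-injective (length-oneTo (suc n)))

  -- weightSum d ys and altSum d n satisfy the same recurrence, which only sees the relative order of the entries.
  relabelInvariant : ∀ n → RelabelInvariant n
  relabelInvariant = <-rec RelabelInvariant step
    where
    step : ∀ n → (∀ {m} → m < n → RelabelInvariant m) → RelabelInvariant n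
    step zero _ d [] [] ≡.refl = refl
    step (suc n) ih d (x ∷ xs) inc |x∷xs|≡1+n = begin
      weightSum d (x ∷ xs)  ≈⟨ weightSum-min∷-recurrence n (λ m≤n → ih (s≤s m≤n)) d x xs inc (ℕₚ.suc-injective |x∷xs|≡1+n) ⟩
      minRecurrence d n     ≈⟨ altSum-suc-relabel n (λ m≤n → ih (s≤s m≤n)) d ⟨
      altSum d (suc n)      ∎

  altSum-suc : ∀ d n → altSum d (suc n) ≈ minRecurrence d n
  altSum-suc d n = altSum-suc-relabel n (λ {m} _ → relabelInvariant m) d

module QTangentSecant {c ℓ} (R : CommutativeRing c ℓ) (q : CommutativeRing.Carrier R) where
  open import Data.Bool using (Bool; true; false; not; if_then_else_; _∧_; T?)
  open import Data.Bool.Properties using (not-involutive)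
  open import Data.List using (List; []; _∷_; filter; map)
  open CommutativeRing R hiding (zero)
  open QNumbers R
  open FiniteSums R
  open QExponentialSeries R q
  open QTrigonometry R q
  open AlternatingPermutations R q
  open Parity
  open Permutations using (minFits; flips)
  open IntegerCoefficientSolver R using (solve; _:=_; _:+_; _:*_; :-_; :0; :1)
  open import Relation.Binary.Reasoning.Setoid setoid

  ofParity : Bool → ℕ → Bool
  ofParity d i = if d then odd i else not (odd i)

  flips≡ofParity-suc : ∀ d i → flips d i ≡ ofParity d (suc i)
  flips≡ofParity-suc true zero = ≡.refl
  flips≡ofParity-suc false zero = ≡.refl
  flips≡ofParity-suc true (suc i) = flips≡ofParity-suc false i
  flips≡ofParity-suc false (suc i) = ≡.trans (flips≡ofParity-suc true i) (≡.sym (not-involutive _))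

  minFits≡ofParity : ∀ d m i → minFits d i (suc m ∸ i) ≡ ofParity d i
  minFits≡ofParity true m zero = ≡.refl
  minFits≡ofParity false m zero = ≡.refl
  minFits≡ofParity d m (suc i) = flips≡ofParity-suc d i

  ofParity-∧ : ∀ d m i → i ≤ suc m → ofParity d (suc (suc m)) ∧ ofParity d i ≡ ofParity d i ∧ odd (suc m ∸ i)
  ofParity-∧ d m i i≤1+m rewrite odd-∸ (suc m) i i≤1+m with d | odd m | odd i
  ... | true  | true  | true  = ≡.refl
  ... | true  | true  | false = ≡.refl
  ... | true  | false | true  = ≡.refl
  ... | true  | false | false = ≡.refl
  ... | false | true  | true  = ≡.refl
  ... | false | true  | false = ≡.refl
  ... | false | false | true  = ≡.refl
  ... | false | false | false = ≡.refl

  altPart : Bool → Seq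
  altPart d n = ind (ofParity d n) * altSum d n

  tanq secq : Seq
  tanq = altPart true
  secq = altPart false

  -- Only the terms with i of the parity of d survive, and for those suc m ∸ i is odd.
  altPart-suc-suc : ∀ d m → altPart d (suc (suc m)) ≈ (dilate (altPart d) ⊛ tanq) (suc m)
  altPart-suc-suc d m = begin
    ind (ofParity d (2 ℕ.+ m)) * altSum d (2 ℕ.+ m)
      ≈⟨ *-congˡ (altSum-suc d (suc m)) ⟩
    ind (ofParity d (2 ℕ.+ m)) * minRecurrence d (suc m)
      ≈⟨ *-distribˡ-Σ (ind (ofParity d (2 ℕ.+ m))) (minSummand d (suc m)) (suc m) ⟩
    Σ (λ i → ind (ofParity d (2 ℕ.+ m)) * minSummand d (suc m) i) (suc m)
      ≈⟨ Σ-cong (suc m) term ⟩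
    (dilate (altPart d) ⊛ tanq) (suc m) ∎
    where
    term : ∀ i → i ≤ suc m → ind (ofParity d (2 ℕ.+ m)) * minSummand d (suc m) i
      ≈ qbin i (suc m ∸ i) * (pow q i * (ind (ofParity d i) * altSum d i)) * (ind (odd (suc m ∸ i)) * altSum true (suc m ∸ i))
    term i i≤1+m = begin
      P₂₊ₘ * (pow q i * ind (minFits d i (suc m ∸ i)) * A * B * qbinom q (suc m) i)
        ≡⟨ ≡.cong (λ b → P₂₊ₘ * (pow q i * ind b * A * B * qbinom q (suc m) i)) (minFits≡ofParity d m i) ⟩
      P₂₊ₘ * (pow q i * Pᵢ * A * B * qbinom q (suc m) i)
        ≈⟨ solve 6 (λ x p y a b c → x :* (p :* y :* a :* b :* c) := (x :* y) :* (p :* a :* b :* c)) refl P₂₊ₘ (pow q i) Pᵢ A B _ ⟩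
      (P₂₊ₘ * Pᵢ) * (pow q i * A * B * qbinom q (suc m) i)
        ≈⟨ *-cong P₂₊ₘPᵢ≈PᵢOᵢ (*-congˡ (qbinom≈qbin (suc m) i i≤1+m)) ⟩
      (Pᵢ * Oᵢ) * (pow q i * A * B * qbin i (suc m ∸ i))
        ≈⟨ solve 6 (λ y z p a b c → (y :* z) :* (p :* a :* b :* c) := c :* (p :* (y :* a)) :* (z :* b)) refl Pᵢ Oᵢ (pow q i) A B _ ⟩
      qbin i (suc m ∸ i) * (pow q i * (Pᵢ * A)) * (Oᵢ * B) ∎
      where
      P₂₊ₘ Pᵢ Oᵢ A B : Carrier
      P₂₊ₘ = ind (ofParity d (2 ℕ.+ m))
      Pᵢ = ind (ofParity d i)
      Oᵢ = ind (odd (suc m ∸ i))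
      A = altSum d i
      B = altSum true (suc m ∸ i)
      P₂₊ₘPᵢ≈PᵢOᵢ : P₂₊ₘ * Pᵢ ≈ Pᵢ * Oᵢ
      P₂₊ₘPᵢ≈PᵢOᵢ = trans (sym (ind-∧ _ _)) (trans (reflexive (≡.cong ind (ofParity-∧ d m i i≤1+m))) (ind-∧ _ _))

  altSum-zero : ∀ d → altSum d 0 ≈ 1#
  altSum-zero d = solve 0 (:1 :* :1 :+ :0 := :1) refl

  tanq₀≈0 : tanq 0 ≈ 0#
  tanq₀≈0 = zeroˡ _

  secq₀≈1 : secq 0 ≈ 1#
  secq₀≈1 = trans (*-identityˡ _) (altSum-zero false)

  D-tanq : D tanq ≋ 𝟙 ⊕ dilate tanq ⊛ tanq
  D-tanq zero = begin
    1# * (1# * 1# + 0#)                     ≈⟨ solve 0 (:1 :* (:1 :* :1 :+ :0) := :1) refl ⟩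
    1#                                      ≈⟨ +-identityʳ 1# ⟨
    1# + 0#                                 ≈⟨ +-congˡ (trans (*-congˡ tanq₀≈0) (zeroʳ _)) ⟨
    1# + 1# * (1# * tanq 0) * tanq 0        ∎
  D-tanq (suc m) = trans (altPart-suc-suc true m) (sym (+-identityˡ _))

  D-secq : D secq ≋ dilate secq ⊛ tanq
  D-secq zero = trans (zeroˡ _) (sym (trans (*-congˡ tanq₀≈0) (zeroʳ _)))
  D-secq (suc m) = altPart-suc-suc false m

  Dtanq⊛negPochOdd≋dilate-secq⊛sin : D tanq ⊛ negPochOdd ≋ dilate secq ⊛ sinq
  Dtanq⊛negPochOdd≋dilate-secq⊛sin = Dt⊛negPochOdd≋dilate-s⊛sin tanq secq tanq₀≈0 secq₀≈1 D-tanq D-secq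

  D-tanq-odd≈0 : ∀ i → odd i ≡ true → D tanq i ≈ 0#
  D-tanq-odd≈0 i oddi rewrite oddi = zeroˡ _

  dilate-secq-odd≈0 : ∀ i → odd i ≡ true → dilate secq i ≈ 0#
  dilate-secq-odd≈0 i oddi rewrite oddi = trans (*-congˡ (zeroˡ _)) (zeroʳ _)

  Σˡ-filter : ∀ (P : List ℕ → Bool) (g : List ℕ → Carrier) πs →
              sumR (map g (filter (λ π → T? (P π)) πs)) ≈ Σˡ (λ π → ind (P π) * g π) πs
  Σˡ-filter P g [] = refl
  Σˡ-filter P g (π ∷ πs) with P π
  ... | true = +-cong (sym (*-identityˡ _)) (Σˡ-filter P g πs)
  ... | false = trans (Σˡ-filter P g πs) (sym (trans (+-congʳ (zeroˡ _)) (+-identityˡ _)))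

  invSum≈altSum : ∀ d n → invSum q (alt d) n ≈ altSum d n
  invSum≈altSum d n = Σˡ-filter (alt d) (λ π → pow q (inv π)) (perms (oneTo n))

  tanq-odd : ∀ k → tanq (suc (2 ℕ.* k)) ≈ qTan q k
  tanq-odd k rewrite odd-2* k = trans (*-identityˡ _) (sym (invSum≈altSum true (suc (2 ℕ.* k))))

  secq-even : ∀ k → secq (2 ℕ.* k) ≈ qSec q k
  secq-even zero = secq₀≈1
  secq-even (suc k) rewrite odd-2* (suc k) = trans (*-identityˡ _) (sym (invSum≈altSum false (2 ℕ.* suc k)))

  sinq-odd : ∀ m → sinq (suc (2 ℕ.* m)) ≈ signed m 1#
  sinq-odd zero = refl
  sinq-odd (suc m) = trans (reflexive (≡.cong (λ k → sinq (suc k)) (2*-suc m))) (-‿cong (sinq-odd m))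

  negPochOdd-odd : ∀ m → negPochOdd (suc (2 ℕ.* m)) ≈ signed m (negqPoch q (2 ℕ.* m))
  negPochOdd-odd zero = solve 0 (:1 :+ :0 :+ :1 :* :0 := :1) refl
  negPochOdd-odd (suc m) = begin
    negPochOdd (suc (2 ℕ.* suc m))
      ≡⟨ ≡.cong (λ k → negPochOdd (suc k)) (2*-suc m) ⟩
    0# + negPochEven (2 ℕ.+ 2 ℕ.* m) + q₂ * negPochEven (2 ℕ.+ 2 ℕ.* m)
      ≈⟨ solve 3 (λ b p₁ p₂ → :0 :+ :- (b :+ p₁ :* b) :+ p₂ :* :- (b :+ p₁ :* b) := :- (b :* (:1 :+ p₁) :* (:1 :+ p₂)))
                 refl B q₁ q₂ ⟩
    - (B * (1# + q₁) * (1# + q₂))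
      ≈⟨ -‿cong (*-congʳ (*-congʳ (negPochOdd-odd m))) ⟩
    - (signed m (negqPoch q (2 ℕ.* m)) * (1# + q₁) * (1# + q₂))
      ≈⟨ -‿cong (trans (*-congʳ (signed-*ˡ m _ _)) (signed-*ˡ m _ _)) ⟩
    - signed m (negqPoch q (2 ℕ.* m) * (1# + q₁) * (1# + q₂))
      ≡⟨ ≡.cong (λ k → signed (suc m) (negqPoch q k)) (2*-suc m) ⟨
    signed (suc m) (negqPoch q (2 ℕ.* suc m)) ∎
    where
    B q₁ q₂ : Carrier
    B = negPochOdd (suc (2 ℕ.* m))
    q₁ = pow q (suc (2 ℕ.* m))
    q₂ = pow q (2 ℕ.+ 2 ℕ.* m)

  lhs≈tangent-coefficient : ∀ n → lhs q n ≈ signed n ((D tanq ⊛ negPochOdd) (suc (2 ℕ.* n)))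
  lhs≈tangent-coefficient n = begin
    lhs q n
      ≈⟨ sumTo≈Σ n _ ⟩
    Σ (λ k → signed k (qbinom q (suc (2 ℕ.* n)) (2 ℕ.* k) * negqPoch q (2 ℕ.* n ∸ 2 ℕ.* k) * qTan q k)) n
      ≈⟨ Σ-cong′ n term ⟩
    Σ (λ k → signed k (qbinom q (suc (2 ℕ.* n)) (2 ℕ.* k) * D tanq (2 ℕ.* k) * negqPoch q (2 ℕ.* (n ∸ k)))) n
      ≈⟨ signed-⊛-at-odd (D tanq) negPochOdd (λ m → negqPoch q (2 ℕ.* m)) n D-tanq-odd≈0 negPochOdd-odd ⟨
    signed n ((D tanq ⊛ negPochOdd) (suc (2 ℕ.* n))) ∎
    where
    term : ∀ k → signed k (qbinom q (suc (2 ℕ.* n)) (2 ℕ.* k) * negqPoch q (2 ℕ.* n ∸ 2 ℕ.* k) * qTan q k)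
               ≈ signed k (qbinom q (suc (2 ℕ.* n)) (2 ℕ.* k) * D tanq (2 ℕ.* k) * negqPoch q (2 ℕ.* (n ∸ k)))
    term k = signed-cong k (begin
      Q * negqPoch q (2 ℕ.* n ∸ 2 ℕ.* k) * qTan q k
        ≈⟨ *-cong (*-congˡ (reflexive (≡.cong (negqPoch q) (≡.sym (ℕₚ.*-distribˡ-∸ 2 n k))))) (sym (tanq-odd k)) ⟩
      Q * negqPoch q (2 ℕ.* (n ∸ k)) * D tanq (2 ℕ.* k)
        ≈⟨ solve 3 (λ a b c → a :* b :* c := a :* c :* b) refl Q _ _ ⟩
      Q * D tanq (2 ℕ.* k) * negqPoch q (2 ℕ.* (n ∸ k)) ∎)
      where
      Q : Carrier
      Q = qbinom q (suc (2 ℕ.* n)) (2 ℕ.* k)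

  rhs≈secant-coefficient : ∀ n → rhs q n ≈ signed n ((dilate secq ⊛ sinq) (suc (2 ℕ.* n)))
  rhs≈secant-coefficient n = begin
    rhs q n
      ≈⟨ sumTo≈Σ n _ ⟩
    Σ (λ k → signed k (qbinom q (suc (2 ℕ.* n)) (2 ℕ.* k) * pow q (2 ℕ.* k) * qSec q k)) n
      ≈⟨ Σ-cong′ n term ⟩
    Σ (λ k → signed k (qbinom q (suc (2 ℕ.* n)) (2 ℕ.* k) * dilate secq (2 ℕ.* k) * 1#)) n
      ≈⟨ signed-⊛-at-odd (dilate secq) sinq (λ _ → 1#) n dilate-secq-odd≈0 sinq-odd ⟨
    signed n ((dilate secq ⊛ sinq) (suc (2 ℕ.* n))) ∎
    where
    term : ∀ k → signed k (qbinom q (suc (2 ℕ.* n)) (2 ℕ.* k) * pow q (2 ℕ.* k) * qSec q k)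
               ≈ signed k (qbinom q (suc (2 ℕ.* n)) (2 ℕ.* k) * dilate secq (2 ℕ.* k) * 1#)
    term k = signed-cong k (begin
      Q * pow q (2 ℕ.* k) * qSec q k             ≈⟨ *-congˡ (secq-even k) ⟨
      Q * pow q (2 ℕ.* k) * secq (2 ℕ.* k)       ≈⟨ solve 3 (λ a b c → a :* b :* c := a :* (b :* c) :* :1) refl Q _ _ ⟩
      Q * dilate secq (2 ℕ.* k) * 1#             ∎)
      where
      Q : Carrier
      Q = qbinom q (suc (2 ℕ.* n)) (2 ℕ.* k)

theorem4p5 : ∀ {c ℓ} (R : CommutativeRing c ℓ) (q : CommutativeRing.Carrier R) (n : ℕ) →
    CommutativeRing._≈_ R (QNumbers.lhs R q n) (QNumbers.rhs R q n)
theorem4p5 R q n = begin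
  lhs q n                                           ≈⟨ lhs≈tangent-coefficient n ⟩
  signed n ((D tanq ⊛ negPochOdd) (suc (2 ℕ.* n)))  ≈⟨ signed-cong n (Dtanq⊛negPochOdd≋dilate-secq⊛sin (suc (2 ℕ.* n))) ⟩
  signed n ((dilate secq ⊛ sinq) (suc (2 ℕ.* n)))   ≈⟨ rhs≈secant-coefficient n ⟨
  rhs q n                                           ∎
  where
  open CommutativeRing R using (setoid)
  open QNumbers R using (lhs; rhs; signed)
  open FiniteSums R using (signed-cong)
  open QExponentialSeries R q using (D; dilate; _⊛_)
  open QTrigonometry R q using (sinq; negPochOdd)
  open QTangentSecant R q
  open import Relation.Binary.Reasoning.Setoid setoid
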